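{- If $n=2^j\ge4$, then $\Phi_4(t)^2=(t^2+1)^2$ divides the descent set polynomial $Q_n(t)$.
   Context: For $S\subseteq[n-1]=\{1,\dots,n-1\}$, $\beta_n(S)$ is the number of permutations $\pi\in\mathfrak{S}_n$ with descent set $\{i:\pi_i>\pi_{i+1}\}$ equal to $S$, and $Q_n(t)=\sum_{S\subseteq[n-1]}t^{\beta_n(S)}$. $\Phi_k(t)$ denotes the $k$-th cyclotomic polynomial. -}

module Defs where

open import Data.Bool using (Bool; true; false)
open import Data.Nat using (ℕ; zero; suc; _∸_; _<ᵇ_)
open import Data.Integer using (ℤ; +_)
import Data.Integer as ℤ
open import Data.Fin using (Fin; toℕ)
import Data.Fin.Properties as FinP
open import Data.List using (List; []; _∷_; map; concatMap; allFin; filter; length)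
import Data.List.Relation.Unary.Unique.DecPropositional as UniqueDec
open import Data.List.Relation.Binary.Equality.DecPropositional (Data.Bool._≟_) using (_≡?_)
open import Relation.Binary.PropositionalEquality using (_≡_)
open import Data.Product using (∃)
import Data.Bool

-- Permutations of [n] in one-line notation: π ∈ 𝔖ₙ is the word
-- π₁ π₂ … πₙ, a list of length n over Fin n (value v stands for v+1)
-- with no repeated entries.

words : {A : Set} → List A → ℕ → List (List A)
words xs zero    = [] ∷ []
words xs (suc k) = concatMap (λ x → map (x ∷_) (words xs k)) xs

perms : (n : ℕ) → List (List (Fin n))
perms n = filter (UniqueDec.unique? (FinP._≟_ {n})) (words (allFin n) n)

-- Descent sets.  A subset S ⊆ [n-1] is encoded by its characteristic
-- vector: a Bool list of length n-1 whose i-th entry (i = 1..n-1) says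
-- whether i ∈ S.

descentSet : {n : ℕ} → List (Fin n) → List Bool
descentSet []            = []
descentSet (x ∷ [])      = []
descentSet (x ∷ y ∷ ws)  = (toℕ y <ᵇ toℕ x) ∷ descentSet (y ∷ ws)

subsets : ℕ → List (List Bool)
subsets n = words (true ∷ false ∷ []) (n ∸ 1)

β : (n : ℕ) → List Bool → ℕ
β n S = length (filter (λ π → descentSet π ≡? S) (perms n))

-- Polynomials in ℤ[t], as coefficient lists (constant term first).

Poly : Set
Poly = List ℤ

_+ₚ_ : Poly → Poly → Poly
[]       +ₚ q        = q
p        +ₚ []       = p
(a ∷ p)  +ₚ (b ∷ q)  = (a ℤ.+ b) ∷ (p +ₚ q)

scale : ℤ → Poly → Poly
scale c = map (c ℤ.*_)

_*ₚ_ : Poly → Poly → Poly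
[]      *ₚ q = []
(a ∷ p) *ₚ q = scale a q +ₚ (+ 0 ∷ (p *ₚ q))

monomial : ℕ → Poly
monomial zero    = + 1 ∷ []
monomial (suc k) = + 0 ∷ monomial k

coeff : Poly → ℕ → ℤ
coeff []      _       = + 0
coeff (a ∷ p) zero    = a
coeff (a ∷ p) (suc k) = coeff p k

-- equality of polynomials (coefficientwise, ignoring trailing zeros)
_≈ₚ_ : Poly → Poly → Set
p ≈ₚ q = ∀ k → coeff p k ≡ coeff q k

_∣ₚ_ : Poly → Poly → Set
d ∣ₚ p = ∃ λ q → (d *ₚ q) ≈ₚ p

sumₚ : List Poly → Poly
sumₚ []       = []
sumₚ (p ∷ ps) = p +ₚ sumₚ ps

Q : ℕ → Poly
Q n = sumₚ (map (λ S → monomial (β n S)) (subsets n))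

Φ₄ : Poly
Φ₄ = + 1 ∷ + 0 ∷ + 1 ∷ []

-- Write n = 2^j = 2m. As (t² + 1)² = (t − i)² (t + i)², the remainder of tᵇ modulo it is
-- determined by iᵇ and b, and it suffices that these remainders sum to zero over all S.
-- Splitting at a position k gives β_n(S ∖ {k}) + β_n(S ∪ {k}) = C(n, k) β(left part) β(right part),
-- where C(n, k) ≡ 0 (mod 4) for 0 < k < n, k ≠ m, while C(n, m) ≡ 2 (mod 4) and every β_m(R) is
-- odd. Adding the elements of S one at a time thus yields β_n(S) ≡ 2 − ε(S) (mod 4), where
-- ε(S) = (−1)^|S ∖ {m}|, so i^β_n(S) = ε(S) i. The remainder sum then vanishes because
-- Σ_S ε(S) = 0 (toggle an element other than m) and Σ_S ε(S) β_n(S) = 0: summing over whether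
-- m ∈ S factors the sum through Σ_R ε(R) β_m(R), which is zero since complementing R preserves
-- β_m and, |R| = m − 1 being odd, reverses ε(R).

module Submission where

open import Defs
open import Algebra.Bundles using (Semiring)
open import Data.Bool using (Bool; true; false)
open import Data.List using (List; []; _∷_)
open import Data.Nat using (ℕ; zero; suc; _^_; _≤_; s≤s)

bits : List Bool
bits = true ∷ false ∷ []

module ListSum {c ℓ} (R : Semiring c ℓ) where

  open import Level using (Level)
  open import Data.Nat using () renaming (_+_ to _+ℕ_)
  open import Data.Bool using (not)
  open import Data.List using (_++_; map; concatMap; length)

  open Semiring R
  open import Algebra.Properties.CommutativeSemigroup +-commutativeSemigroup using (interchange)
  open import Relation.Binary.Reasoning.Setoid setoid
  import Relation.Binary.PropositionalEquality as ≡
  open import Relation.Binary.PropositionalEquality using (_≡_)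

  private variable
    a b : Level
    A B : Set a

  ∑ : (A → Carrier) → List A → Carrier
  ∑ f []       = 0#
  ∑ f (x ∷ xs) = f x + ∑ f xs

  ∑-cong : {f g : A → Carrier} → (∀ x → f x ≈ g x) → ∀ xs → ∑ f xs ≈ ∑ g xs
  ∑-cong f≈g []       = refl
  ∑-cong f≈g (x ∷ xs) = +-cong (f≈g x) (∑-cong f≈g xs)

  ∑-++ : (f : A → Carrier) (xs ys : List A) → ∑ f (xs ++ ys) ≈ ∑ f xs + ∑ f ys
  ∑-++ f []       ys = sym (+-identityˡ _)
  ∑-++ f (x ∷ xs) ys = trans (+-congˡ (∑-++ f xs ys)) (sym (+-assoc _ _ _))

  ∑-map : (f : B → Carrier) (g : A → B) (xs : List A) → ∑ f (map g xs) ≈ ∑ (λ x → f (g x)) xs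
  ∑-map f g []       = refl
  ∑-map f g (x ∷ xs) = +-congˡ (∑-map f g xs)

  ∑-concatMap : (f : B → Carrier) (g : A → List B) (xs : List A) →
                ∑ f (concatMap g xs) ≈ ∑ (λ x → ∑ f (g x)) xs
  ∑-concatMap f g []       = refl
  ∑-concatMap f g (x ∷ xs) = trans (∑-++ f (g x) (concatMap g xs)) (+-congˡ (∑-concatMap f g xs))

  ∑-zero : (xs : List A) → ∑ (λ _ → 0#) xs ≈ 0#
  ∑-zero []       = refl
  ∑-zero (x ∷ xs) = trans (+-identityˡ _) (∑-zero xs)

  ∑-+ : (f g : A → Carrier) (xs : List A) → ∑ (λ x → f x + g x) xs ≈ ∑ f xs + ∑ g xs
  ∑-+ f g []       = sym (+-identityˡ 0#)
  ∑-+ f g (x ∷ xs) = trans (+-congˡ (∑-+ f g xs)) (interchange _ _ _ _)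

  ∑-*ˡ : (k : Carrier) (f : A → Carrier) (xs : List A) → ∑ (λ x → k * f x) xs ≈ k * ∑ f xs
  ∑-*ˡ k f []       = sym (zeroʳ k)
  ∑-*ˡ k f (x ∷ xs) = trans (+-congˡ (∑-*ˡ k f xs)) (sym (distribˡ k _ _))

  ∑-words-suc : (xs : List A) (k : ℕ) (f : List A → Carrier) →
                ∑ f (words xs (suc k)) ≈ ∑ (λ x → ∑ (λ w → f (x ∷ w)) (words xs k)) xs
  ∑-words-suc xs k f =
    trans (∑-concatMap f (λ x → map (x ∷_) (words xs k)) xs) (∑-cong (λ x → ∑-map f (x ∷_) (words xs k)) xs)

  ∑-words-cong : (xs : List A) (k : ℕ) {f g : List A → Carrier} →
                 (∀ w → length w ≡ k → f w ≈ g w) → ∑ f (words xs k) ≈ ∑ g (words xs k)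
  ∑-words-cong xs zero    f≈g = +-congʳ (f≈g [] ≡.refl)
  ∑-words-cong xs (suc k) {f} {g} f≈g = begin
    ∑ f (words xs (suc k))                                   ≈⟨ ∑-words-suc xs k f ⟩
    ∑ (λ x → ∑ (λ w → f (x ∷ w)) (words xs k)) xs            ≈⟨ ∑-cong (λ x → ∑-words-cong xs k (λ w e → f≈g (x ∷ w) (≡.cong suc e))) xs ⟩
    ∑ (λ x → ∑ (λ w → g (x ∷ w)) (words xs k)) xs            ≈⟨ ∑-words-suc xs k g ⟨
    ∑ g (words xs (suc k))                                   ∎

  ∑-words-++ : (xs : List A) (k l : ℕ) (f : List A → Carrier) →
               ∑ f (words xs (k +ℕ l)) ≈ ∑ (λ u → ∑ (λ v → f (u ++ v)) (words xs l)) (words xs k)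
  ∑-words-++ xs zero    l f = sym (+-identityʳ _)
  ∑-words-++ xs (suc k) l f = begin
    ∑ f (words xs (suc k +ℕ l))                                              ≈⟨ ∑-words-suc xs (k +ℕ l) f ⟩
    ∑ (λ x → ∑ (λ w → f (x ∷ w)) (words xs (k +ℕ l))) xs                      ≈⟨ ∑-cong (λ x → ∑-words-++ xs k l (λ w → f (x ∷ w))) xs ⟩
    ∑ (λ x → ∑ (λ u → ∑ (λ v → f (x ∷ u ++ v)) (words xs l)) (words xs k)) xs ≈⟨ ∑-words-suc xs k (λ u → ∑ (λ v → f (u ++ v)) (words xs l)) ⟨
    ∑ (λ u → ∑ (λ v → f (u ++ v)) (words xs l)) (words xs (suc k))            ∎

  ∑-words-complement : (k : ℕ) (f : List Bool → Carrier) → ∑ f (words bits k) ≈ ∑ (λ w → f (map not w)) (words bits k)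
  ∑-words-complement zero    f = refl
  ∑-words-complement (suc k) f = begin
    ∑ f (words bits (suc k))
      ≈⟨ ∑-words-suc bits k f ⟩
    ∑ (λ w → f (true ∷ w)) (words bits k) + (∑ (λ w → f (false ∷ w)) (words bits k) + 0#)
      ≈⟨ +-cong (∑-words-complement k (λ w → f (true ∷ w))) (+-congʳ (∑-words-complement k (λ w → f (false ∷ w)))) ⟩
    ∑ (λ w → f (true ∷ map not w)) (words bits k) + (∑ (λ w → f (false ∷ map not w)) (words bits k) + 0#)
      ≈⟨ swap _ _ ⟩
    ∑ (λ w → f (false ∷ map not w)) (words bits k) + (∑ (λ w → f (true ∷ map not w)) (words bits k) + 0#)
      ≈⟨ ∑-words-suc bits k (λ w → f (map not w)) ⟨
    ∑ (λ w → f (map not w)) (words bits (suc k))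
      ∎
    where
    swap : ∀ x y → x + (y + 0#) ≈ y + (x + 0#)
    swap x y = trans (+-congˡ (+-identityʳ y)) (trans (+-comm x y) (+-congˡ (sym (+-identityʳ x))))

module Counting where

  open import Level using (0ℓ)
  open import Function using (_∘_)
  open import Function.Bundles using (mk⇔)
  open import Data.Bool using (Bool; true; false; not; _∧_; _xor_)
  import Data.Bool as Bool
  open import Data.Bool.Properties using (not-involutive)
  open import Data.Nat using (ℕ; zero; suc; _+_; _*_; _∸_; _^_; _%_; _/_; _<_; _≤_; _<ᵇ_; _≟_; z≤n; s≤s; NonZero; pred)
  open import Data.Nat.Properties
  open import Data.Nat.DivMod
  open import Data.Nat.Divisibility
  open import Data.Nat.Induction using (<-rec)
  open import Data.Nat.Tactic.RingSolver using (solve-∀)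
  open import Data.Fin using (Fin; zero; suc; toℕ; punchIn)
  import Data.Fin.Properties as Fin
  open import Data.List using (List; []; _∷_; _++_; length; map; replicate; filter; allFin; tabulate)
  open import Data.List.Properties using (length-++; length-map; length-replicate; ++-identityʳ)
  import Data.List.Relation.Unary.All as All
  import Data.List.Relation.Unary.Unique.DecPropositional as UniqueDec
  import Data.List.Relation.Unary.Unique.Propositional.Properties as Unique
  open import Data.List.Relation.Binary.Equality.DecPropositional (Bool._≟_) using (_≡?_)
  open import Data.Product using (∃₂; _×_; _,_)
  open import Data.Sum using (_⊎_; inj₁; inj₂)
  open import Relation.Nullary using (Dec; yes; no; does; ¬?; contradiction)
  open import Relation.Nullary.Decidable using (does-⇔; dec-true; dec-false)
  open import Relation.Unary using (Pred; Decidable)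
  open import Relation.Binary.PropositionalEquality
  open ≡-Reasoning
  open import Algebra.Properties.CommutativeSemigroup +-commutativeSemigroup using () renaming (interchange to +-interchange)
  open import Algebra.Properties.CommutativeMonoid.Sum +-0-commutativeMonoid using (sum; sum-remove; sum-cong-≗)
  open ListSum +-*-semiring

  -- Sums over antidiagonals and binomial identities

  𝟙 : Bool → ℕ
  𝟙 true  = 1
  𝟙 false = 0

  𝟙-split : ∀ b y → 𝟙 b * y + 𝟙 (not b) * y ≡ y
  𝟙-split true  y = trans (+-identityʳ (y + 0)) (+-identityʳ y)
  𝟙-split false y = +-identityʳ y

  antidiag : ℕ → (ℕ → ℕ → ℕ) → ℕ
  antidiag zero    f = f 0 0
  antidiag (suc n) f = f 0 (suc n) + antidiag n (λ i j → f (suc i) j)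

  antidiag⁻ : ℕ → (ℕ → ℕ → ℕ) → ℕ
  antidiag⁻ zero    f = 0
  antidiag⁻ (suc n) f = antidiag n f

  antidiag-cong : ∀ n {f g : ℕ → ℕ → ℕ} → (∀ i j → i + j ≡ n → f i j ≡ g i j) → antidiag n f ≡ antidiag n g
  antidiag-cong zero    f≡g = f≡g 0 0 refl
  antidiag-cong (suc n) f≡g = cong₂ _+_ (f≡g 0 (suc n) refl) (antidiag-cong n (λ i j e → f≡g (suc i) j (cong suc e)))

  antidiag⁻-cong : ∀ n {f g : ℕ → ℕ → ℕ} → (∀ i j → suc (i + j) ≡ n → f i j ≡ g i j) → antidiag⁻ n f ≡ antidiag⁻ n g
  antidiag⁻-cong zero    f≡g = refl
  antidiag⁻-cong (suc n) f≡g = antidiag-cong n (λ i j e → f≡g i j (cong suc e))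

  antidiag-zero : ∀ n → antidiag n (λ _ _ → 0) ≡ 0
  antidiag-zero zero    = refl
  antidiag-zero (suc n) = antidiag-zero n

  antidiag-+ : ∀ n (f g : ℕ → ℕ → ℕ) → antidiag n (λ i j → f i j + g i j) ≡ antidiag n f + antidiag n g
  antidiag-+ zero    f g = refl
  antidiag-+ (suc n) f g = trans (cong (f 0 (suc n) + g 0 (suc n) +_) (antidiag-+ n (λ i j → f (suc i) j) (λ i j → g (suc i) j)))
                                 (+-interchange (f 0 (suc n)) (g 0 (suc n)) _ _)

  antidiag-*ˡ : ∀ n c (f : ℕ → ℕ → ℕ) → antidiag n (λ i j → c * f i j) ≡ c * antidiag n f
  antidiag-*ˡ zero    c f = refl
  antidiag-*ˡ (suc n) c f = trans (cong (c * f 0 (suc n) +_) (antidiag-*ˡ n c _)) (sym (*-distribˡ-+ c _ _))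

  antidiag-*ʳ : ∀ n c (f : ℕ → ℕ → ℕ) → antidiag n (λ i j → f i j * c) ≡ antidiag n f * c
  antidiag-*ʳ n c f = trans (antidiag-cong n (λ i j _ → *-comm (f i j) c)) (trans (antidiag-*ˡ n c f) (*-comm c _))

  antidiag⁻-+ : ∀ n (f g : ℕ → ℕ → ℕ) → antidiag⁻ n (λ i j → f i j + g i j) ≡ antidiag⁻ n f + antidiag⁻ n g
  antidiag⁻-+ zero    f g = refl
  antidiag⁻-+ (suc n) f g = antidiag-+ n f g

  antidiag⁻-*ʳ : ∀ n c (f : ℕ → ℕ → ℕ) → antidiag⁻ n (λ i j → f i j * c) ≡ antidiag⁻ n f * c
  antidiag⁻-*ʳ zero    c f = refl
  antidiag⁻-*ʳ (suc n) c f = antidiag-*ʳ n c f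

  antidiag-last : ∀ n (f : ℕ → ℕ → ℕ) → antidiag (suc n) f ≡ antidiag n (λ i j → f i (suc j)) + f (suc n) 0
  antidiag-last zero    f = refl
  antidiag-last (suc n) f = trans (cong (f 0 (suc (suc n)) +_) (antidiag-last n (λ i j → f (suc i) j)))
                                  (sym (+-assoc (f 0 (suc (suc n))) _ _))

  antidiag⁻-last : ∀ n (f : ℕ → ℕ → ℕ) → antidiag⁻ (suc n) f ≡ antidiag⁻ n (λ i j → f i (suc j)) + f n 0
  antidiag⁻-last zero    f = refl
  antidiag⁻-last (suc n) f = antidiag-last n f

  antidiag-swap : ∀ n (f : ℕ → ℕ → ℕ) → antidiag n f ≡ antidiag n (λ i j → f j i)
  antidiag-swap zero    f = refl
  antidiag-swap (suc n) f = begin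
    f 0 (suc n) + antidiag n (λ i j → f (suc i) j)       ≡⟨ cong (f 0 (suc n) +_) (antidiag-swap n (λ i j → f (suc i) j)) ⟩
    f 0 (suc n) + antidiag n (λ i j → f (suc j) i)       ≡⟨ +-comm (f 0 (suc n)) _ ⟩
    antidiag n (λ i j → f (suc j) i) + f 0 (suc n)       ≡⟨ antidiag-last n (λ i j → f j i) ⟨
    antidiag (suc n) (λ i j → f j i)                     ∎

  antidiag⁻-swap : ∀ n (f : ℕ → ℕ → ℕ) → antidiag⁻ n f ≡ antidiag⁻ n (λ i j → f j i)
  antidiag⁻-swap zero    f = refl
  antidiag⁻-swap (suc n) f = antidiag-swap n f

  antidiag-interchange : ∀ n m (F : ℕ → ℕ → ℕ → ℕ → ℕ) →
    antidiag n (λ i j → antidiag m (F i j)) ≡ antidiag m (λ k l → antidiag n (λ i j → F i j k l))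
  antidiag-interchange zero    m F = refl
  antidiag-interchange (suc n) m F =
    trans (cong (antidiag m (F 0 (suc n)) +_) (antidiag-interchange n m (λ i j → F (suc i) j)))
          (sym (antidiag-+ m (F 0 (suc n)) (λ k l → antidiag n (λ i j → F (suc i) j k l))))

  antidiag-head : ∀ n (f : ℕ → ℕ → ℕ) → (∀ i j → f (suc i) j ≡ 0) → antidiag n f ≡ f 0 n
  antidiag-head zero    f f≡0 = refl
  antidiag-head (suc n) f f≡0 =
    trans (cong (f 0 (suc n) +_) (trans (antidiag-cong n (λ i j _ → f≡0 i j)) (antidiag-zero n))) (+-identityʳ _)

  antidiag-𝟙-split : ∀ n (b : ℕ → ℕ → Bool) (f : ℕ → ℕ → ℕ) →
    antidiag n (λ i j → 𝟙 (b i j) * f i j) + antidiag n (λ i j → 𝟙 (not (b i j)) * f i j) ≡ antidiag n f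
  antidiag-𝟙-split n b f = trans (sym (antidiag-+ n _ _)) (antidiag-cong n (λ i j _ → 𝟙-split (b i j) (f i j)))

  binom : ℕ → ℕ → ℕ
  binom n       zero    = 1
  binom zero    (suc k) = 0
  binom (suc n) (suc k) = binom n k + binom n (suc k)

  shift : (ℕ → ℕ) → ℕ → ℕ
  shift g zero    = 0
  shift g (suc i) = g i

  binom-suc : ∀ r i → binom (suc r) i ≡ shift (binom r) i + binom r i
  binom-suc r zero    = refl
  binom-suc r (suc i) = refl

  antidiag-peel : ∀ c (f g : ℕ → ℕ) →
    antidiag c (λ i i′ → f i * g i′) ≡ f 0 * g c + antidiag c (λ i i′ → f (suc i) * shift g i′)
  antidiag-peel zero    f g = sym (trans (cong (f 0 * g 0 +_) (*-zeroʳ (f 1))) (+-identityʳ _))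
  antidiag-peel (suc c) f g = cong (f 0 * g (suc c) +_) (sym (begin
    antidiag (suc c) (λ i i′ → f (suc i) * shift g i′)                       ≡⟨ antidiag-last c (λ i i′ → f (suc i) * shift g i′) ⟩
    antidiag c (λ i i′ → f (suc i) * g i′) + f (suc (suc c)) * 0           ≡⟨ cong (antidiag c (λ i i′ → f (suc i) * g i′) +_) (*-zeroʳ (f (suc (suc c)))) ⟩
    antidiag c (λ i i′ → f (suc i) * g i′) + 0                             ≡⟨ +-identityʳ _ ⟩
    antidiag c (λ i i′ → f (suc i) * g i′)                                 ∎))

  vandermonde : ∀ r r̄ k → antidiag k (λ s s̄ → binom r s * binom r̄ s̄) ≡ binom (r + r̄) k
  vandermonde zero     r̄ zero    = refl
  vandermonde zero     r̄ (suc k) = trans (cong₂ _+_ (*-identityˡ _) (antidiag-zero k)) (+-identityʳ _)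
  vandermonde (suc r) r̄ zero    = refl
  vandermonde (suc r) r̄ (suc k) = begin
    1 * binom r̄ (suc k) + antidiag k (λ i j → binom (suc r) (suc i) * binom r̄ j)
      ≡⟨ cong₂ _+_ (*-identityˡ _) (trans (antidiag-cong k (λ i j _ → *-distribʳ-+ (binom r̄ j) (binom r i) _)) (antidiag-+ k _ _)) ⟩
    binom r̄ (suc k) + (A + B)
      ≡⟨ +-comm-middle (binom r̄ (suc k)) A B ⟩
    A + (1 * binom r̄ (suc k) + B)
      ≡⟨ cong₂ _+_ (vandermonde r r̄ k) (vandermonde r r̄ (suc k)) ⟩
    binom (suc r + r̄) (suc k)
      ∎
    where
    A = antidiag k (λ i j → binom r i * binom r̄ j)
    B = antidiag k (λ i j → binom r (suc i) * binom r̄ j)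
    +-comm-middle : ∀ x y z → x + (y + z) ≡ y + (1 * x + z)
    +-comm-middle x y z = trans (sym (+-assoc x y z)) (trans (cong (_+ z) (+-comm x y))
                          (trans (+-assoc y x z) (cong (λ w → y + (w + z)) (sym (*-identityˡ x)))))

  -- Both sides count the (a + c + 1)-subsets of an (r + r̄)-set whose (a + 1)-st element lies
  -- among the first r: on the left by the position of that element, on the right by how many
  -- elements lie among the first r.
  binom-pivot : ∀ r r̄ a c →
    antidiag⁻ r (λ j j′ → binom j a * binom (r̄ + j′) c) ≡ antidiag c (λ i i′ → binom r (suc (a + i)) * binom r̄ i′)
  binom-pivot zero    r̄ a c = sym (antidiag-zero c)
  binom-pivot (suc r) r̄ a c = begin
    antidiag⁻ (suc r) (λ j j′ → binom j a * binom (r̄ + j′) c)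
      ≡⟨ antidiag⁻-last r _ ⟩
    antidiag⁻ r (λ j j′ → binom j a * binom (r̄ + suc j′) c) + binom r a * binom (r̄ + 0) c
      ≡⟨ cong₂ _+_ (antidiag⁻-cong r (λ j j′ _ → cong (λ z → binom j a * binom z c) (+-suc r̄ j′)))
                   (cong (λ z → binom r a * binom z c) (+-identityʳ r̄)) ⟩
    antidiag⁻ r (λ j j′ → binom j a * binom (suc r̄ + j′) c) + binom r a * binom r̄ c
      ≡⟨ cong (_+ binom r a * binom r̄ c) (binom-pivot r (suc r̄) a c) ⟩
    antidiag c (λ i i′ → binom r (suc (a + i)) * binom (suc r̄) i′) + binom r a * binom r̄ c
      ≡⟨ cong (_+ binom r a * binom r̄ c) (trans (antidiag-cong c (λ i i′ _ →
           trans (cong (binom r (suc (a + i)) *_) (binom-suc r̄ i′)) (*-distribˡ-+ (binom r (suc (a + i))) _ _)))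
           (antidiag-+ c _ _)) ⟩
    (X + Y) + binom r a * binom r̄ c
      ≡⟨ rotate X Y (binom r a * binom r̄ c) ⟩
    (binom r a * binom r̄ c + X) + Y
      ≡⟨ cong (_+ Y) (sym peeled) ⟩
    antidiag c (λ i i′ → binom r (a + i) * binom r̄ i′) + Y
      ≡⟨ sym (antidiag-+ c _ _) ⟩
    antidiag c (λ i i′ → binom r (a + i) * binom r̄ i′ + binom r (suc (a + i)) * binom r̄ i′)
      ≡⟨ antidiag-cong c (λ i i′ _ → sym (*-distribʳ-+ (binom r̄ i′) (binom r (a + i)) _)) ⟩
    antidiag c (λ i i′ → binom (suc r) (suc (a + i)) * binom r̄ i′)
      ∎
    where
    X = antidiag c (λ i i′ → binom r (suc (a + i)) * shift (binom r̄) i′)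
    Y = antidiag c (λ i i′ → binom r (suc (a + i)) * binom r̄ i′)
    rotate : ∀ x y z → (x + y) + z ≡ (z + x) + y
    rotate x y z = trans (+-assoc x y z) (trans (cong (x +_) (+-comm y z))
                   (trans (sym (+-assoc x z y)) (cong (_+ y) (+-comm x z))))
    peeled : antidiag c (λ i i′ → binom r (a + i) * binom r̄ i′) ≡ binom r a * binom r̄ c + X
    peeled = trans (antidiag-peel c (λ i → binom r (a + i)) (binom r̄))
                   (cong₂ _+_ (cong (λ z → binom r z * binom r̄ c) (+-identityʳ a))
                              (antidiag-cong c (λ i i′ _ → cong (λ z → binom r z * shift (binom r̄) i′) (+-suc a i))))

  antidiag-binom-zero : ∀ c (f : ℕ → ℕ) → antidiag c (λ i i′ → f i * binom 0 i′) ≡ f c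
  antidiag-binom-zero zero    f = *-identityʳ (f 0)
  antidiag-binom-zero (suc c) f = trans (cong (_+ antidiag c (λ i i′ → f (suc i) * binom 0 i′)) (*-zeroʳ (f 0))) (antidiag-binom-zero c (λ i → f (suc i)))

  upper-vandermonde : ∀ P a c → antidiag P (λ x x̄ → binom x a * binom x̄ c) ≡ binom (suc P) (suc (a + c))
  upper-vandermonde P a c =
    trans (binom-pivot (suc P) 0 a c) (antidiag-binom-zero c (λ i → binom (suc P) (suc (a + i))))

  antidiag-𝟙<-restrict : ∀ P r r̄ (f : ℕ → ℕ → ℕ) → r + r̄ ≡ suc P →
    antidiag P (λ x x̄ → 𝟙 (x <ᵇ r) * f x x̄) ≡ antidiag⁻ r (λ j j′ → f j (r̄ + j′))
  antidiag-𝟙<-restrict P       zero          r̄       f e = antidiag-zero P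
  antidiag-𝟙<-restrict zero    (suc zero)    zero    f refl = +-identityʳ (f 0 0)
  antidiag-𝟙<-restrict (suc P) (suc zero)    r̄       f e = begin
    (f 0 (suc P) + 0) + antidiag P (λ _ _ → 0)   ≡⟨ cong₂ _+_ (+-identityʳ _) (antidiag-zero P) ⟩
    f 0 (suc P) + 0                            ≡⟨ +-identityʳ _ ⟩
    f 0 (suc P)                                ≡⟨ cong (f 0) (sym (trans (+-identityʳ r̄) (suc-injective e))) ⟩
    f 0 (r̄ + 0)                                ∎
  antidiag-𝟙<-restrict (suc P) (suc (suc r)) r̄ f e =
    cong₂ _+_ (trans (+-identityʳ _) (cong (f 0) (sym (trans (+-comm r̄ (suc r)) (suc-injective e)))))
              (antidiag-𝟙<-restrict P (suc r) r̄ (λ x x̄ → f (suc x) x̄) (suc-injective e))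

  antidiag-𝟙>-restrict : ∀ a c (g : ℕ → ℕ → ℕ) →
    antidiag (suc (a + c)) (λ u ū → 𝟙 (a <ᵇ u) * g u ū) ≡ antidiag c (λ i i′ → g (suc (a + i)) i′)
  antidiag-𝟙>-restrict zero    c g = antidiag-cong c (λ i j _ → +-identityʳ _)
  antidiag-𝟙>-restrict (suc a) c g = antidiag-𝟙>-restrict a c (λ u ū → g (suc u) ū)

  -- A (a + c + 1)-subset of a (P + 1)-set, cut into its first r and last r̄ points, has more than
  -- a elements among the first r exactly when its (a + 1)-st element x satisfies x < r.
  binom-rank-below : ∀ P r r̄ a c → r + r̄ ≡ suc P →
    antidiag P (λ x x̄ → 𝟙 (x <ᵇ r) * (binom x a * binom x̄ c))
      ≡ antidiag (suc (a + c)) (λ u ū → 𝟙 (a <ᵇ u) * (binom r u * binom r̄ ū))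
  binom-rank-below P r r̄ a c e = begin
    antidiag P (λ x x̄ → 𝟙 (x <ᵇ r) * (binom x a * binom x̄ c))
      ≡⟨ antidiag-𝟙<-restrict P r r̄ (λ x x̄ → binom x a * binom x̄ c) e ⟩
    antidiag⁻ r (λ j j′ → binom j a * binom (r̄ + j′) c)
      ≡⟨ binom-pivot r r̄ a c ⟩
    antidiag c (λ i i′ → binom r (suc (a + i)) * binom r̄ i′)
      ≡⟨ antidiag-𝟙>-restrict a c (λ u ū → binom r u * binom r̄ ū) ⟨
    antidiag (suc (a + c)) (λ u ū → 𝟙 (a <ᵇ u) * (binom r u * binom r̄ ū))
      ∎

  binom-rank-above : ∀ P r r̄ a c → r + r̄ ≡ suc P →
    antidiag P (λ x x̄ → 𝟙 (not (x <ᵇ r)) * (binom x a * binom x̄ c))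
      ≡ antidiag (suc (a + c)) (λ u ū → 𝟙 (not (a <ᵇ u)) * (binom r u * binom r̄ ū))
  binom-rank-above P r r̄ a c e = +-cancelˡ-≡ below _ _ (begin
    below + antidiag P (λ x x̄ → 𝟙 (not (x <ᵇ r)) * (binom x a * binom x̄ c))
      ≡⟨ antidiag-𝟙-split P (λ x _ → x <ᵇ r) (λ x x̄ → binom x a * binom x̄ c) ⟩
    antidiag P (λ x x̄ → binom x a * binom x̄ c)
      ≡⟨ upper-vandermonde P a c ⟩
    binom (suc P) (suc (a + c))
      ≡⟨ cong (λ z → binom z (suc (a + c))) e ⟨
    binom (r + r̄) (suc (a + c))
      ≡⟨ vandermonde r r̄ (suc (a + c)) ⟨
    antidiag (suc (a + c)) (λ u ū → binom r u * binom r̄ ū)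
      ≡⟨ antidiag-𝟙-split (suc (a + c)) (λ u _ → a <ᵇ u) (λ u ū → binom r u * binom r̄ ū) ⟨
    antidiag (suc (a + c)) (λ u ū → 𝟙 (a <ᵇ u) * (binom r u * binom r̄ ū)) + _
      ≡⟨ cong (_+ _) (binom-rank-below P r r̄ a c e) ⟨
    below + antidiag (suc (a + c)) (λ u ū → 𝟙 (not (a <ᵇ u)) * (binom r u * binom r̄ ū))
      ∎)
    where below = antidiag P (λ x x̄ → 𝟙 (x <ᵇ r) * (binom x a * binom x̄ c))

  -- Counting permutations by descent set and first entry

  step : Bool → ℕ → ℕ → ℕ
  step true  x r = 𝟙 (x <ᵇ r)
  step false x r = 𝟙 (not (x <ᵇ r))

  binom-rank : ∀ b P r r̄ a c → r + r̄ ≡ suc P →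
    antidiag P (λ x x̄ → step b x r * (binom x a * binom x̄ c))
      ≡ antidiag (suc (a + c)) (λ u ū → step b a u * (binom r u * binom r̄ ū))
  binom-rank true  = binom-rank-below
  binom-rank false = binom-rank-above

  -- βfirst L r r̄ counts the words of length |L| + 1 with distinct entries from {0, …, r + r̄}
  -- starting with r and having descent set L; when r + r̄ = |L| these are the permutations
  -- with descent set L whose first entry exceeds exactly r of the others.
  βfirst : List Bool → ℕ → ℕ → ℕ
  βfirst []      r r̄ = 1
  βfirst (b ∷ L) r r̄ = antidiag⁻ (r + r̄) (λ x x̄ → step b x r * βfirst L x x̄)

  βcount : List Bool → ℕ
  βcount S = antidiag (length S) (βfirst S)

  -- Sort the words counted by βfirst L r r̄ by the sets of s values below r and s̄ values above r they use.
  βfirst-choose : ∀ L r r̄ → βfirst L r r̄ ≡ antidiag (length L) (λ s s̄ → binom r s * binom r̄ s̄ * βfirst L s s̄)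
  βfirst-choose []      r r̄ = refl
  βfirst-choose (b ∷ L) r r̄ with r + r̄ in r+r̄≡
  ... | zero = sym (trans (antidiag-cong (suc ℓ) vanish) (antidiag-zero (suc ℓ)))
    where
    ℓ = length L
    vanish : ∀ u ū → u + ū ≡ suc ℓ → binom r u * binom r̄ ū * βfirst (b ∷ L) u ū ≡ 0
    vanish (suc u) ū _ rewrite m+n≡0⇒m≡0 r r+r̄≡ = refl
    vanish zero (suc ū) _ rewrite m+n≡0⇒n≡0 r r+r̄≡ = refl
  ... | suc P = begin
    antidiag P (λ x x̄ → step b x r * βfirst L x x̄)
      ≡⟨ antidiag-cong P (λ x x̄ _ → trans (cong (step b x r *_) (βfirst-choose L x x̄)) (sym (antidiag-*ˡ ℓ (step b x r) _))) ⟩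
    antidiag P (λ x x̄ → antidiag ℓ (λ s s̄ → step b x r * (binom x s * binom x̄ s̄ * βfirst L s s̄)))
      ≡⟨ antidiag-interchange P ℓ (λ x x̄ s s̄ → step b x r * (binom x s * binom x̄ s̄ * βfirst L s s̄)) ⟩
    antidiag ℓ (λ s s̄ → antidiag P (λ x x̄ → step b x r * (binom x s * binom x̄ s̄ * βfirst L s s̄)))
      ≡⟨ antidiag-cong ℓ (λ s s̄ s+s̄≡ℓ → ranked s s̄ s+s̄≡ℓ) ⟩
    antidiag ℓ (λ s s̄ → antidiag (suc ℓ) (λ u ū → binom r u * binom r̄ ū * (step b s u * βfirst L s s̄)))
      ≡⟨ antidiag-interchange (suc ℓ) ℓ (λ u ū s s̄ → binom r u * binom r̄ ū * (step b s u * βfirst L s s̄)) ⟨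
    antidiag (suc ℓ) (λ u ū → antidiag ℓ (λ s s̄ → binom r u * binom r̄ ū * (step b s u * βfirst L s s̄)))
      ≡⟨ antidiag-cong (suc ℓ) (λ u ū u+ū≡ → trans (antidiag-*ˡ ℓ (binom r u * binom r̄ ū) _)
           (cong (λ z → binom r u * binom r̄ ū * antidiag⁻ z (λ x x̄ → step b x u * βfirst L x x̄)) (sym u+ū≡))) ⟩
    antidiag (suc ℓ) (λ u ū → binom r u * binom r̄ ū * βfirst (b ∷ L) u ū)
      ∎
    where
    ℓ = length L
    ranked : ∀ s s̄ → s + s̄ ≡ ℓ →
      antidiag P (λ x x̄ → step b x r * (binom x s * binom x̄ s̄ * βfirst L s s̄))
        ≡ antidiag (suc ℓ) (λ u ū → binom r u * binom r̄ ū * (step b s u * βfirst L s s̄))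
    ranked s s̄ s+s̄≡ℓ = begin
      antidiag P (λ x x̄ → step b x r * (binom x s * binom x̄ s̄ * βfirst L s s̄))
        ≡⟨ antidiag-cong P (λ x x̄ _ → reassoc (step b x r) (binom x s) (binom x̄ s̄) (βfirst L s s̄)) ⟩
      antidiag P (λ x x̄ → step b x r * (binom x s * binom x̄ s̄) * βfirst L s s̄)
        ≡⟨ antidiag-*ʳ P (βfirst L s s̄) (λ x x̄ → step b x r * (binom x s * binom x̄ s̄)) ⟩
      antidiag P (λ x x̄ → step b x r * (binom x s * binom x̄ s̄)) * βfirst L s s̄
        ≡⟨ cong (_* βfirst L s s̄) (binom-rank b P r r̄ s s̄ r+r̄≡) ⟩
      antidiag (suc (s + s̄)) (λ u ū → step b s u * (binom r u * binom r̄ ū)) * βfirst L s s̄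
        ≡⟨ cong (λ z → antidiag (suc z) (λ u ū → step b s u * (binom r u * binom r̄ ū)) * βfirst L s s̄) s+s̄≡ℓ ⟩
      antidiag (suc ℓ) (λ u ū → step b s u * (binom r u * binom r̄ ū)) * βfirst L s s̄
        ≡⟨ antidiag-*ʳ (suc ℓ) (βfirst L s s̄) (λ u ū → step b s u * (binom r u * binom r̄ ū)) ⟨
      antidiag (suc ℓ) (λ u ū → step b s u * (binom r u * binom r̄ ū) * βfirst L s s̄)
        ≡⟨ antidiag-cong (suc ℓ) (λ u ū _ → reorder (step b s u) (binom r u) (binom r̄ ū) (βfirst L s s̄)) ⟩
      antidiag (suc ℓ) (λ u ū → binom r u * binom r̄ ū * (step b s u * βfirst L s s̄))
        ∎
      where
      reassoc : ∀ w x y z → w * (x * y * z) ≡ w * (x * y) * z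
      reassoc = solve-∀
      reorder : ∀ w x y z → w * (x * y) * z ≡ x * y * (w * z)
      reorder = solve-∀

  βfirst-split : ∀ L R r r̄ → r + r̄ ≡ length L + suc (length R) →
    βfirst (L ++ false ∷ R) r r̄ + βfirst (L ++ true ∷ R) r r̄ ≡ βfirst L r r̄ * βcount R
  βfirst-split [] R r r̄ e = begin
    antidiag⁻ (r + r̄) (λ x x̄ → step false x r * βfirst R x x̄) + antidiag⁻ (r + r̄) (λ x x̄ → step true x r * βfirst R x x̄)
      ≡⟨ cong (λ z → antidiag⁻ z (λ x x̄ → step false x r * βfirst R x x̄) + antidiag⁻ z (λ x x̄ → step true x r * βfirst R x x̄)) e ⟩
    antidiag (length R) (λ x x̄ → step false x r * βfirst R x x̄) + antidiag (length R) (λ x x̄ → step true x r * βfirst R x x̄)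
      ≡⟨ +-comm (antidiag (length R) (λ x x̄ → step false x r * βfirst R x x̄)) _ ⟩
    antidiag (length R) (λ x x̄ → 𝟙 (x <ᵇ r) * βfirst R x x̄) + antidiag (length R) (λ x x̄ → 𝟙 (not (x <ᵇ r)) * βfirst R x x̄)
      ≡⟨ antidiag-𝟙-split (length R) (λ x _ → x <ᵇ r) (βfirst R) ⟩
    βcount R
      ≡⟨ *-identityˡ (βcount R) ⟨
    1 * βcount R
      ∎
  βfirst-split (c ∷ L) R r r̄ e = begin
    antidiag⁻ (r + r̄) (λ x x̄ → step c x r * βfirst (L ++ false ∷ R) x x̄) + antidiag⁻ (r + r̄) (λ x x̄ → step c x r * βfirst (L ++ true ∷ R) x x̄)
      ≡⟨ antidiag⁻-+ (r + r̄) (λ x x̄ → step c x r * βfirst (L ++ false ∷ R) x x̄) (λ x x̄ → step c x r * βfirst (L ++ true ∷ R) x x̄) ⟨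
    antidiag⁻ (r + r̄) (λ x x̄ → step c x r * βfirst (L ++ false ∷ R) x x̄ + step c x r * βfirst (L ++ true ∷ R) x x̄)
      ≡⟨ antidiag⁻-cong (r + r̄) (λ x x̄ e′ → trans (sym (*-distribˡ-+ (step c x r) _ _))
           (trans (cong (step c x r *_) (βfirst-split L R x x̄ (suc-injective (trans e′ e)))) (sym (*-assoc (step c x r) _ _)))) ⟩
    antidiag⁻ (r + r̄) (λ x x̄ → step c x r * βfirst L x x̄ * βcount R)
      ≡⟨ antidiag⁻-*ʳ (r + r̄) (βcount R) (λ x x̄ → step c x r * βfirst L x x̄) ⟩
    βfirst (c ∷ L) r r̄ * βcount R
      ∎

  -- Choose the |L| + 1 values the word uses.
  antidiag-βfirst : ∀ L M → antidiag M (βfirst L) ≡ binom (suc M) (suc (length L)) * βcount L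
  antidiag-βfirst L M = begin
    antidiag M (βfirst L)
      ≡⟨ antidiag-cong M (λ r r̄ _ → βfirst-choose L r r̄) ⟩
    antidiag M (λ r r̄ → antidiag ℓ (λ s s̄ → binom r s * binom r̄ s̄ * βfirst L s s̄))
      ≡⟨ antidiag-interchange M ℓ (λ r r̄ s s̄ → binom r s * binom r̄ s̄ * βfirst L s s̄) ⟩
    antidiag ℓ (λ s s̄ → antidiag M (λ r r̄ → binom r s * binom r̄ s̄ * βfirst L s s̄))
      ≡⟨ antidiag-cong ℓ (λ s s̄ s+s̄≡ℓ → trans (antidiag-*ʳ M (βfirst L s s̄) (λ r r̄ → binom r s * binom r̄ s̄))
           (cong (_* βfirst L s s̄) (trans (upper-vandermonde M s s̄) (cong (λ z → binom (suc M) (suc z)) s+s̄≡ℓ)))) ⟩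
    antidiag ℓ (λ s s̄ → binom (suc M) (suc ℓ) * βfirst L s s̄)
      ≡⟨ antidiag-*ˡ ℓ (binom (suc M) (suc ℓ)) (βfirst L) ⟩
    binom (suc M) (suc ℓ) * βcount L
      ∎
    where ℓ = length L

  -- Fixing the descent/ascent at position |L| + 1 to be either one removes the only constraint
  -- linking the first |L| + 1 entries to the rest.
  βcount-split : ∀ L R →
    βcount (L ++ false ∷ R) + βcount (L ++ true ∷ R) ≡ binom (suc (length L + suc (length R))) (suc (length L)) * βcount L * βcount R
  βcount-split L R = begin
    βcount (L ++ false ∷ R) + βcount (L ++ true ∷ R)
      ≡⟨ cong₂ (λ z z′ → antidiag z (βfirst (L ++ false ∷ R)) + antidiag z′ (βfirst (L ++ true ∷ R))) (length-++ L) (length-++ L) ⟩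
    antidiag M (βfirst (L ++ false ∷ R)) + antidiag M (βfirst (L ++ true ∷ R))
      ≡⟨ antidiag-+ M (βfirst (L ++ false ∷ R)) (βfirst (L ++ true ∷ R)) ⟨
    antidiag M (λ r r̄ → βfirst (L ++ false ∷ R) r r̄ + βfirst (L ++ true ∷ R) r r̄)
      ≡⟨ antidiag-cong M (βfirst-split L R) ⟩
    antidiag M (λ r r̄ → βfirst L r r̄ * βcount R)
      ≡⟨ antidiag-*ʳ M (βcount R) (βfirst L) ⟩
    antidiag M (βfirst L) * βcount R
      ≡⟨ cong (_* βcount R) (antidiag-βfirst L M) ⟩
    binom (suc M) (suc (length L)) * βcount L * βcount R
      ∎
    where M = length L + suc (length R)

  <ᵇ-suc-+ : ∀ a b → (b <ᵇ suc (a + b)) ≡ true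
  <ᵇ-suc-+ a zero    = refl
  <ᵇ-suc-+ a (suc b) = trans (cong (b <ᵇ_) (+-suc a b)) (<ᵇ-suc-+ a b)

  +-<ᵇ : ∀ a b → (a + b <ᵇ b) ≡ false
  +-<ᵇ a zero    = refl
  +-<ᵇ a (suc b) = trans (cong (_<ᵇ suc b) (+-suc a b)) (+-<ᵇ a b)

  <ᵇ-complement : ∀ x x̄ r r̄ → suc (x + x̄) ≡ r + r̄ → (x <ᵇ r) ≡ not (x̄ <ᵇ r̄)
  <ᵇ-complement zero    x̄ zero    r̄ e = cong not (sym (trans (cong (x̄ <ᵇ_) (sym e)) (<ᵇ-suc-+ 0 x̄)))
  <ᵇ-complement zero    x̄ (suc r) r̄ e = cong not (sym (trans (cong (_<ᵇ r̄) (suc-injective e)) (+-<ᵇ r r̄)))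
  <ᵇ-complement (suc x) x̄ zero    r̄ e = cong not (sym (trans (cong (x̄ <ᵇ_) (sym e)) (<ᵇ-suc-+ (suc x) x̄)))
  <ᵇ-complement (suc x) x̄ (suc r) r̄ e = <ᵇ-complement x x̄ r r̄ (suc-injective e)

  step-complement : ∀ b x x̄ r r̄ → suc (x + x̄) ≡ r + r̄ → step (not b) x r ≡ step b x̄ r̄
  step-complement true  x x̄ r r̄ e = cong 𝟙 (trans (cong not (<ᵇ-complement x x̄ r r̄ e)) (not-involutive _))
  step-complement false x x̄ r r̄ e = cong 𝟙 (<ᵇ-complement x x̄ r r̄ e)

  βfirst-complement : ∀ L r r̄ → βfirst (map not L) r r̄ ≡ βfirst L r̄ r
  βfirst-complement []      r r̄ = refl
  βfirst-complement (b ∷ L) r r̄ = begin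
    antidiag⁻ (r + r̄) (λ x x̄ → step (not b) x r * βfirst (map not L) x x̄)
      ≡⟨ antidiag⁻-cong (r + r̄) (λ x x̄ e → cong₂ _*_ (step-complement b x x̄ r r̄ e) (βfirst-complement L x x̄)) ⟩
    antidiag⁻ (r + r̄) (λ x x̄ → step b x̄ r̄ * βfirst L x̄ x)
      ≡⟨ antidiag⁻-swap (r + r̄) (λ x x̄ → step b x̄ r̄ * βfirst L x̄ x) ⟩
    antidiag⁻ (r + r̄) (λ x x̄ → step b x r̄ * βfirst L x x̄)
      ≡⟨ cong (λ z → antidiag⁻ z (λ x x̄ → step b x r̄ * βfirst L x x̄)) (+-comm r r̄) ⟩
    antidiag⁻ (r̄ + r) (λ x x̄ → step b x r̄ * βfirst L x x̄)
      ∎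

  βcount-complement : ∀ L → βcount (map not L) ≡ βcount L
  βcount-complement L = begin
    antidiag (length (map not L)) (βfirst (map not L))   ≡⟨ cong (λ z → antidiag z (βfirst (map not L))) (length-map not L) ⟩
    antidiag (length L) (βfirst (map not L))             ≡⟨ antidiag-cong (length L) (λ r r̄ _ → βfirst-complement L r r̄) ⟩
    antidiag (length L) (λ r r̄ → βfirst L r̄ r)          ≡⟨ antidiag-swap (length L) (βfirst L) ⟨
    βcount L                                             ∎

  isZero : ℕ → ℕ
  isZero zero    = 1
  isZero (suc _) = 0

  βfirst-ascending : ∀ a r r̄ → r + r̄ ≡ a → βfirst (replicate a false) r r̄ ≡ isZero r
  βfirst-ascending zero    zero r̄ e = refl
  βfirst-ascending (suc a) r    r̄ e = begin
    antidiag⁻ (r + r̄) (λ x x̄ → step false x r * βfirst (replicate a false) x x̄)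
      ≡⟨ cong (λ z → antidiag⁻ z (λ x x̄ → step false x r * βfirst (replicate a false) x x̄)) e ⟩
    antidiag a (λ x x̄ → step false x r * βfirst (replicate a false) x x̄)
      ≡⟨ antidiag-cong a (λ x x̄ e′ → cong (step false x r *_) (βfirst-ascending a x x̄ e′)) ⟩
    antidiag a (λ x x̄ → step false x r * isZero x)
      ≡⟨ antidiag-head a (λ x x̄ → step false x r * isZero x) (λ i j → *-zeroʳ (step false (suc i) r)) ⟩
    step false 0 r * 1
      ≡⟨ starts-at-zero r ⟩
    isZero r
      ∎
    where
    starts-at-zero : ∀ r → step false 0 r * 1 ≡ isZero r
    starts-at-zero zero    = refl
    starts-at-zero (suc r) = refl

  βcount-ascending : ∀ a → βcount (replicate a false) ≡ 1
  βcount-ascending a = begin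
    antidiag (length (replicate a false)) (βfirst (replicate a false))
      ≡⟨ cong (λ z → antidiag z (βfirst (replicate a false))) (length-replicate a) ⟩
    antidiag a (βfirst (replicate a false))
      ≡⟨ antidiag-cong a (βfirst-ascending a) ⟩
    antidiag a (λ r _ → isZero r)
      ≡⟨ antidiag-head a (λ r _ → isZero r) (λ i j → refl) ⟩
    1
      ∎

  -- The recursion agrees with the enumeration β

  length-filter-∑ : {A : Set} {P : Pred A 0ℓ} (P? : Decidable P) (xs : List A) → length (filter P? xs) ≡ ∑ (λ x → 𝟙 (does (P? x))) xs
  length-filter-∑ P? []       = refl
  length-filter-∑ P? (x ∷ xs) with does (P? x)
  ... | true  = cong suc (length-filter-∑ P? xs)
  ... | false = length-filter-∑ P? xs

  ∑-filter : {A : Set} {P : Pred A 0ℓ} (P? : Decidable P) (f : A → ℕ) (xs : List A) →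
             ∑ f (filter P? xs) ≡ ∑ (λ x → 𝟙 (does (P? x)) * f x) xs
  ∑-filter P? f []       = refl
  ∑-filter P? f (x ∷ xs) with does (P? x)
  ... | true  = cong₂ _+_ (sym (+-identityʳ (f x))) (∑-filter P? f xs)
  ... | false = ∑-filter P? f xs

  ∑-tabulate : {A : Set} (n : ℕ) (g : Fin n → A) (h : A → ℕ) → ∑ h (tabulate g) ≡ sum (λ i → h (g i))
  ∑-tabulate zero    g h = refl
  ∑-tabulate (suc n) g h = cong (h (g zero) +_) (∑-tabulate n (λ i → g (suc i)) h)

  ∑-allFin : ∀ n (h : Fin n → ℕ) → ∑ h (allFin n) ≡ sum h
  ∑-allFin n h = ∑-tabulate n (λ i → i) h

  sum-antidiag : ∀ n (g : ℕ → ℕ → ℕ) → sum {suc n} (λ y → g (toℕ y) (n ∸ toℕ y)) ≡ antidiag n g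
  sum-antidiag zero    g = +-identityʳ _
  sum-antidiag (suc n) g = cong (g 0 (suc n) +_) (sum-antidiag n (λ i j → g (suc i) j))

  𝟙-∧ : ∀ a b h → 𝟙 (a ∧ b) * h ≡ 𝟙 a * (𝟙 b * h)
  𝟙-∧ true  b h = sym (+-identityʳ _)
  𝟙-∧ false b h = refl

  Words : (n : ℕ) → ℕ → List (List (Fin n))
  Words n k = words (allFin n) k

  avoids : ∀ {n} → Fin n → List (Fin n) → Bool
  avoids x w = does (All.all? (λ y → ¬? (x Fin.≟ y)) w)

  -- Deleting x from the alphabet Fin (suc n) and renumbering is the bijection punchIn x : Fin n → Fin (suc n) ∖ {x}.
  ∑-words-avoiding : ∀ n (x : Fin (suc n)) k (h : List (Fin (suc n)) → ℕ) →
    ∑ (λ w → 𝟙 (avoids x w) * h w) (Words (suc n) k) ≡ ∑ (λ σ → h (map (punchIn x) σ)) (Words n k)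
  ∑-words-avoiding n x zero    h = cong (_+ 0) (+-identityʳ (h []))
  ∑-words-avoiding n x (suc k) h = begin
    ∑ (λ w → 𝟙 (avoids x w) * h w) (Words (suc n) (suc k))
      ≡⟨ ∑-words-suc (allFin (suc n)) k _ ⟩
    ∑ (λ y → ∑ (λ w → 𝟙 (avoids x (y ∷ w)) * h (y ∷ w)) (Words (suc n) k)) (allFin (suc n))
      ≡⟨ ∑-allFin (suc n) _ ⟩
    sum (λ y → ∑ (λ w → 𝟙 (avoids x (y ∷ w)) * h (y ∷ w)) (Words (suc n) k))
      ≡⟨ sum-cong-≗ (λ y → trans (∑-cong (λ w → 𝟙-∧ (x≢ y) (avoids x w) (h (y ∷ w))) (Words (suc n) k))
                        (trans (∑-*ˡ (𝟙 (x≢ y)) _ (Words (suc n) k))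
                               (cong (𝟙 (x≢ y) *_) (∑-words-avoiding n x k (λ w → h (y ∷ w)))))) ⟩
    sum (λ y → 𝟙 (x≢ y) * tail y)
      ≡⟨ sum-remove {i = x} (λ y → 𝟙 (x≢ y) * tail y) ⟩
    𝟙 (x≢ x) * tail x + sum (λ z → 𝟙 (x≢ (punchIn x z)) * tail (punchIn x z))
      ≡⟨ cong₂ _+_ (cong (λ b → 𝟙 (not b) * tail x) (dec-true (x Fin.≟ x) refl))
                   (sum-cong-≗ (λ z → trans (cong (λ b → 𝟙 (not b) * tail (punchIn x z))
                                                (dec-false (x Fin.≟ punchIn x z) (λ e → Fin.punchInᵢ≢i x z (sym e))))
                                          (+-identityʳ _))) ⟩
    sum (λ z → tail (punchIn x z))
      ≡⟨ ∑-allFin n _ ⟨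
    ∑ (λ z → tail (punchIn x z)) (allFin n)
      ≡⟨ ∑-words-suc (allFin n) k (λ σ → h (map (punchIn x) σ)) ⟨
    ∑ (λ σ → h (map (punchIn x) σ)) (Words n (suc k))
      ∎
    where
    x≢ : Fin (suc n) → Bool
    x≢ y = not (does (x Fin.≟ y))
    tail : Fin (suc n) → ℕ
    tail y = ∑ (λ σ → h (y ∷ map (punchIn x) σ)) (Words n k)

  isUnique : ∀ {n} → List (Fin n) → Bool
  isUnique w = does (UniqueDec.unique? Fin._≟_ w)

  isUnique-punchIn : ∀ {n} (x : Fin (suc n)) (σ : List (Fin n)) → isUnique (map (punchIn x) σ) ≡ isUnique σ
  isUnique-punchIn x σ = does-⇔ (mk⇔ Unique.map⁻ (Unique.map⁺ (Fin.punchIn-injective x _ _)))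
                                (UniqueDec.unique? Fin._≟_ (map (punchIn x) σ)) (UniqueDec.unique? Fin._≟_ σ)

  -- A permutation of Fin (suc n) is its first entry x followed by a permutation of Fin n relabelled by punchIn x.
  ∑-perms-suc : ∀ n (h : List (Fin (suc n)) → ℕ) →
    ∑ h (perms (suc n)) ≡ sum (λ x → ∑ (λ σ → h (x ∷ map (punchIn x) σ)) (perms n))
  ∑-perms-suc n h = begin
    ∑ h (perms (suc n))
      ≡⟨ ∑-filter (UniqueDec.unique? Fin._≟_) h (Words (suc n) (suc n)) ⟩
    ∑ (λ w → 𝟙 (isUnique w) * h w) (Words (suc n) (suc n))
      ≡⟨ ∑-words-suc (allFin (suc n)) n _ ⟩
    ∑ (λ x → ∑ (λ w → 𝟙 (isUnique (x ∷ w)) * h (x ∷ w)) (Words (suc n) n)) (allFin (suc n))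
      ≡⟨ ∑-allFin (suc n) _ ⟩
    sum (λ x → ∑ (λ w → 𝟙 (isUnique (x ∷ w)) * h (x ∷ w)) (Words (suc n) n))
      ≡⟨ sum-cong-≗ (λ x → tails x) ⟩
    sum (λ x → ∑ (λ σ → h (x ∷ map (punchIn x) σ)) (perms n))
      ∎
    where
    tails : ∀ x → ∑ (λ w → 𝟙 (isUnique (x ∷ w)) * h (x ∷ w)) (Words (suc n) n) ≡ ∑ (λ σ → h (x ∷ map (punchIn x) σ)) (perms n)
    tails x = begin
      ∑ (λ w → 𝟙 (isUnique (x ∷ w)) * h (x ∷ w)) (Words (suc n) n)
        ≡⟨ ∑-cong (λ w → 𝟙-∧ (avoids x w) (isUnique w) (h (x ∷ w))) (Words (suc n) n) ⟩
      ∑ (λ w → 𝟙 (avoids x w) * (𝟙 (isUnique w) * h (x ∷ w))) (Words (suc n) n)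
        ≡⟨ ∑-words-avoiding n x n (λ w → 𝟙 (isUnique w) * h (x ∷ w)) ⟩
      ∑ (λ σ → 𝟙 (isUnique (map (punchIn x) σ)) * h (x ∷ map (punchIn x) σ)) (Words n n)
        ≡⟨ ∑-cong (λ σ → cong (λ b → 𝟙 b * h (x ∷ map (punchIn x) σ)) (isUnique-punchIn x σ)) (Words n n) ⟩
      ∑ (λ σ → 𝟙 (isUnique σ) * h (x ∷ map (punchIn x) σ)) (Words n n)
        ≡⟨ ∑-filter (UniqueDec.unique? Fin._≟_) (λ σ → h (x ∷ map (punchIn x) σ)) (Words n n) ⟨
      ∑ (λ σ → h (x ∷ map (punchIn x) σ)) (perms n)
        ∎

  punchIn-<ᵇ : ∀ {n} (x : Fin (suc n)) (a b : Fin n) → (toℕ (punchIn x a) <ᵇ toℕ (punchIn x b)) ≡ (toℕ a <ᵇ toℕ b)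
  punchIn-<ᵇ zero    a       b       = refl
  punchIn-<ᵇ (suc x) zero    zero    = refl
  punchIn-<ᵇ (suc x) zero    (suc b) = refl
  punchIn-<ᵇ (suc x) (suc a) zero    = refl
  punchIn-<ᵇ (suc x) (suc a) (suc b) = punchIn-<ᵇ x a b

  punchIn-<ᵇ-self : ∀ {n} (x : Fin (suc n)) (y : Fin n) → (toℕ (punchIn x y) <ᵇ toℕ x) ≡ (toℕ y <ᵇ toℕ x)
  punchIn-<ᵇ-self zero    y       = refl
  punchIn-<ᵇ-self (suc x) zero    = refl
  punchIn-<ᵇ-self (suc x) (suc y) = punchIn-<ᵇ-self x y

  descentSet-punchIn : ∀ {n} (x : Fin (suc n)) (σ : List (Fin n)) → descentSet (map (punchIn x) σ) ≡ descentSet σ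
  descentSet-punchIn x []          = refl
  descentSet-punchIn x (a ∷ [])     = refl
  descentSet-punchIn x (a ∷ b ∷ σ) = cong₂ _∷_ (punchIn-<ᵇ x b a) (descentSet-punchIn x (b ∷ σ))

  𝟙-≟-step : ∀ b x r → 𝟙 (does ((x <ᵇ r) Bool.≟ b)) ≡ step b x r
  𝟙-≟-step true  x r with x <ᵇ r
  ... | true  = refl
  ... | false = refl
  𝟙-≟-step false x r with x <ᵇ r
  ... | true  = refl
  ... | false = refl

  𝟙-∧-* : ∀ a b → 𝟙 (a ∧ b) ≡ 𝟙 a * 𝟙 b
  𝟙-∧-* true  b = sym (+-identityʳ _)
  𝟙-∧-* false b = refl

  hasDescentSet : ∀ {n} → List Bool → List (Fin n) → ℕ
  hasDescentSet S w = 𝟙 (does (descentSet w ≡? S))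

  hasDescentSet-cons : ∀ {n} b S (x : Fin (suc n)) (y : Fin n) τ →
    hasDescentSet (b ∷ S) (x ∷ map (punchIn x) (y ∷ τ)) ≡ step b (toℕ y) (toℕ x) * hasDescentSet S (y ∷ τ)
  hasDescentSet-cons b S x y τ = begin
    𝟙 (does ((toℕ (punchIn x y) <ᵇ toℕ x) Bool.≟ b) ∧ does (descentSet (map (punchIn x) (y ∷ τ)) ≡? S))
      ≡⟨ 𝟙-∧-* (does ((toℕ (punchIn x y) <ᵇ toℕ x) Bool.≟ b)) (does (descentSet (map (punchIn x) (y ∷ τ)) ≡? S)) ⟩
    𝟙 (does ((toℕ (punchIn x y) <ᵇ toℕ x) Bool.≟ b)) * hasDescentSet S (map (punchIn x) (y ∷ τ))
      ≡⟨ cong₂ (λ c D → 𝟙 (does (c Bool.≟ b)) * 𝟙 (does (D ≡? S))) (punchIn-<ᵇ-self x y) (descentSet-punchIn x (y ∷ τ)) ⟩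
    𝟙 (does ((toℕ y <ᵇ toℕ x) Bool.≟ b)) * hasDescentSet S (y ∷ τ)
      ≡⟨ cong (_* hasDescentSet S (y ∷ τ)) (𝟙-≟-step b (toℕ y) (toℕ x)) ⟩
    step b (toℕ y) (toℕ x) * hasDescentSet S (y ∷ τ)
      ∎

  βfirst-perms : ∀ n S → length S ≡ n → (x : Fin (suc n)) →
    ∑ (λ σ → hasDescentSet S (x ∷ map (punchIn x) σ)) (perms n) ≡ βfirst S (toℕ x) (n ∸ toℕ x)
  βfirst-perms zero    []      _ x = refl
  βfirst-perms (suc n) (b ∷ S) e x = begin
    ∑ (λ σ → hasDescentSet (b ∷ S) (x ∷ map (punchIn x) σ)) (perms (suc n))
      ≡⟨ ∑-perms-suc n _ ⟩
    sum {suc n} (λ y → ∑ (λ τ → hasDescentSet (b ∷ S) (x ∷ map (punchIn x) (y ∷ map (punchIn y) τ))) (perms n))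
      ≡⟨ sum-cong-≗ {suc n} (λ y → trans (∑-cong (λ τ → hasDescentSet-cons b S x y (map (punchIn y) τ)) (perms n))
                         (trans (∑-*ˡ (step b (toℕ y) (toℕ x)) _ (perms n))
                                (cong (step b (toℕ y) (toℕ x) *_) (βfirst-perms n S (suc-injective e) y)))) ⟩
    sum {suc n} (λ y → step b (toℕ y) (toℕ x) * βfirst S (toℕ y) (n ∸ toℕ y))
      ≡⟨ sum-antidiag n (λ i j → step b i (toℕ x) * βfirst S i j) ⟩
    antidiag n (λ i j → step b i (toℕ x) * βfirst S i j)
      ≡⟨ cong (λ z → antidiag⁻ z (λ i j → step b i (toℕ x) * βfirst S i j)) (m+[n∸m]≡n (≤-pred (Fin.toℕ<n x))) ⟨
    βfirst (b ∷ S) (toℕ x) (suc n ∸ toℕ x)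
      ∎

  β≡βcount : ∀ S → β (suc (length S)) S ≡ βcount S
  β≡βcount S = begin
    β (suc n) S
      ≡⟨ length-filter-∑ (λ π → descentSet π ≡? S) (perms (suc n)) ⟩
    ∑ (hasDescentSet S) (perms (suc n))
      ≡⟨ ∑-perms-suc n (hasDescentSet S) ⟩
    sum {suc n} (λ x → ∑ (λ σ → hasDescentSet S (x ∷ map (punchIn x) σ)) (perms n))
      ≡⟨ sum-cong-≗ {suc n} (βfirst-perms n S refl) ⟩
    sum {suc n} (λ x → βfirst S (toℕ x) (n ∸ toℕ x))
      ≡⟨ sum-antidiag n (βfirst S) ⟩
    βcount S
      ∎
    where n = length S

  -- Binomial coefficients in the rows 2^E and 2^E − 1

  binom-1 : ∀ m → binom m 1 ≡ m
  binom-1 zero    = refl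
  binom-1 (suc m) = cong suc (binom-1 m)

  binom-absorb : ∀ n k → suc k * binom (suc n) (suc k) ≡ suc n * binom n k
  binom-absorb zero    zero    = refl
  binom-absorb zero    (suc k) = *-zeroʳ (suc (suc k))
  binom-absorb (suc n) zero    = trans (*-identityˡ _) (trans (cong suc (binom-1 (suc n))) (sym (*-identityʳ (suc (suc n)))))
  binom-absorb (suc n) (suc k) = begin
    suc (suc k) * (A + A′)
      ≡⟨ expand k A A′ ⟩
    A + (suc k * A + suc (suc k) * A′)
      ≡⟨ cong (A +_) (cong₂ _+_ (binom-absorb n k) (binom-absorb n (suc k))) ⟩
    A + (suc n * binom n k + suc n * binom n (suc k))
      ≡⟨ cong (A +_) (*-distribˡ-+ (suc n) (binom n k) (binom n (suc k))) ⟨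
    suc (suc n) * A
      ∎
    where
    A  = binom (suc n) (suc k)
    A′ = binom (suc n) (suc (suc k))
    expand : ∀ k a b → suc (suc k) * (a + b) ≡ a + (suc k * a + suc (suc k) * b)
    expand = solve-∀

  binom-central : ∀ m → binom (2 * suc m) (suc m) ≡ 2 * binom (m + suc m) m
  binom-central m = *-cancelˡ-≡ _ _ (suc m) (begin
    suc m * binom (2 * suc m) (suc m)          ≡⟨ cong (λ z → suc m * binom z (suc m)) 2*suc≡ ⟩
    suc m * binom (suc (m + suc m)) (suc m)    ≡⟨ binom-absorb (m + suc m) m ⟩
    suc (m + suc m) * binom (m + suc m) m      ≡⟨ cong (_* binom (m + suc m) m) (sym 2*suc≡) ⟩
    2 * suc m * binom (m + suc m) m            ≡⟨ *-comm-assoc 2 (suc m) (binom (m + suc m) m) ⟩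
    suc m * (2 * binom (m + suc m) m)          ∎)
    where
    2*suc≡ : 2 * suc m ≡ suc (m + suc m)
    2*suc≡ = cong (suc m +_) (+-identityʳ (suc m))
    *-comm-assoc : ∀ a b c → a * b * c ≡ b * (a * c)
    *-comm-assoc = solve-∀

  %2-cases : ∀ k → k % 2 ≡ 0 ⊎ k % 2 ≡ 1
  %2-cases k with k % 2 | m%n<n k 2
  ... | 0 | _ = inj₁ refl
  ... | 1 | _ = inj₂ refl
  ... | suc (suc _) | s≤s (s≤s ())

  odd-*-%2 : ∀ o x → o % 2 ≡ 1 → (o * x) % 2 ≡ x % 2
  odd-*-%2 o x o-odd = begin
    (o * x) % 2                ≡⟨ %-distribˡ-* o x 2 ⟩
    ((o % 2) * (x % 2)) % 2    ≡⟨ cong (λ z → (z * (x % 2)) % 2) o-odd ⟩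
    (1 * (x % 2)) % 2          ≡⟨ cong (_% 2) (*-identityˡ (x % 2)) ⟩
    (x % 2) % 2                ≡⟨ m%n%n≡m%n x 2 ⟩
    x % 2                      ∎

  pow2∣odd*⇒pow2∣ : ∀ e o x → o % 2 ≡ 1 → 2 ^ e ∣ o * x → 2 ^ e ∣ x
  pow2∣odd*⇒pow2∣ zero    o x o-odd _ = 1∣ x
  pow2∣odd*⇒pow2∣ (suc e) o x o-odd 2^e∣ox
    with divides q x≡q*2 ← m%n≡0⇒n∣m x 2 (trans (sym (odd-*-%2 o x o-odd)) (n∣m⇒m%n≡0 (o * x) 2 (∣-trans (m∣m*n (2 ^ e)) 2^e∣ox)))
    = subst (2 ^ suc e ∣_) (sym x≡q*2) (subst (2 ^ suc e ∣_) (*-comm 2 q) (*-monoʳ-∣ 2 2^e∣q))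
    where
    x*[y*2]≡2*[x*y] : ∀ x y → x * (y * 2) ≡ 2 * (x * y)
    x*[y*2]≡2*[x*y] = solve-∀
    2^e∣q : 2 ^ e ∣ q
    2^e∣q = pow2∣odd*⇒pow2∣ e o q o-odd (*-cancelˡ-∣ 2 (subst (2 * 2 ^ e ∣_) (trans (cong (o *_) x≡q*2) (x*[y*2]≡2*[x*y] o q)) 2^e∣ox))

  pow2-odd-decomposition : ∀ k → 0 < k → ∃₂ λ a o → o % 2 ≡ 1 × k ≡ 2 ^ a * o
  pow2-odd-decomposition = <-rec _ decompose
    where
    decompose : ∀ k → (∀ {h} → h < k → 0 < h → ∃₂ λ a o → o % 2 ≡ 1 × h ≡ 2 ^ a * o) →
                0 < k → ∃₂ λ a o → o % 2 ≡ 1 × k ≡ 2 ^ a * o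
    decompose k rec 0<k with %2-cases k
    ... | inj₂ k-odd = 0 , k , k-odd , sym (*-identityˡ k)
    ... | inj₁ k-even with m%n≡0⇒n∣m k 2 k-even
    ...   | divides zero    k≡0   = contradiction (subst (0 <_) k≡0 0<k) (<-irrefl refl)
    ...   | divides (suc h) k≡h*2 with rec (subst (suc h <_) (sym k≡h*2) (m<m*n (suc h) 2 (s≤s (s≤s z≤n)))) (s≤s z≤n)
    ...     | a , o , o-odd , h≡ = suc a , o , o-odd , trans k≡h*2 (trans (cong (_* 2) h≡) (p*o*2≡2*p*o (2 ^ a) o))
      where
      p*o*2≡2*p*o : ∀ p o → p * o * 2 ≡ 2 * p * o
      p*o*2≡2*p*o = solve-∀

  odd⇒nonZero : ∀ o → o % 2 ≡ 1 → NonZero o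
  odd⇒nonZero (suc o) _ = _

  binom-absorb-pred : ∀ N k .{{_ : NonZero N}} .{{_ : NonZero k}} → k * binom N k ≡ N * binom (pred N) (pred k)
  binom-absorb-pred (suc n) (suc k) = binom-absorb n k

  -- Both sides of k·C(N, k) = N·C(N − 1, k − 1) carry the factor 2^a, and then the odd part o of
  -- k cannot absorb any of the remaining 2^d.
  binom-pow2-divisible : ∀ a d o → o % 2 ≡ 1 → 2 ^ d ∣ binom (2 ^ (a + d)) (2 ^ a * o)
  binom-pow2-divisible a d o o-odd = pow2∣odd*⇒pow2∣ d o C o-odd (divides C′ (trans oC≡ (*-comm (2 ^ d) C′)))
    where
    instance
      2^a≢0 = m^n≢0 2 a
      o≢0   = odd⇒nonZero o o-odd
      N≢0   = m^n≢0 2 (a + d)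
      k≢0   = m*n≢0 (2 ^ a) o
    C  = binom (2 ^ (a + d)) (2 ^ a * o)
    C′ = binom (pred (2 ^ (a + d))) (pred (2 ^ a * o))
    oC≡ : o * C ≡ 2 ^ d * C′
    oC≡ = *-cancelˡ-≡ (o * C) (2 ^ d * C′) (2 ^ a) (begin
      2 ^ a * (o * C)         ≡⟨ *-assoc (2 ^ a) o C ⟨
      2 ^ a * o * C           ≡⟨ binom-absorb-pred (2 ^ (a + d)) (2 ^ a * o) ⟩
      2 ^ (a + d) * C′        ≡⟨ cong (_* C′) (^-distribˡ-+-* 2 a d) ⟩
      2 ^ a * 2 ^ d * C′      ≡⟨ *-assoc (2 ^ a) (2 ^ d) C′ ⟩
      2 ^ a * (2 ^ d * C′)    ∎)

  exponent-gap : ∀ a o E → o % 2 ≡ 1 → 2 ^ a * o < 2 ^ E → E ≡ a + suc (E ∸ suc a)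
  exponent-gap a o E o-odd k<2^E = sym (trans (+-suc a (E ∸ suc a)) (m+[n∸m]≡n a<E))
    where
    2^a≤k : 2 ^ a ≤ 2 ^ a * o
    2^a≤k = m≤m*n (2 ^ a) o {{odd⇒nonZero o o-odd}}
    a<E : a < E
    a<E = ≰⇒> (λ E≤a → <-irrefl refl (<-≤-trans k<2^E (≤-trans (^-monoʳ-≤ 2 E≤a) 2^a≤k)))

  binom-pow2-even : ∀ E k → 0 < k → k < 2 ^ E → 2 ∣ binom (2 ^ E) k
  binom-pow2-even E k 0<k k<2^E with pow2-odd-decomposition k 0<k
  ... | a , o , o-odd , refl =
    ∣-trans (m∣m*n (2 ^ d)) (subst (λ e → 2 ^ suc d ∣ binom (2 ^ e) (2 ^ a * o)) (sym E≡) (binom-pow2-divisible a (suc d) o o-odd))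
    where
    d  = E ∸ suc a
    E≡ = exponent-gap a o E o-odd k<2^E

  a≡j : ∀ {a j} → suc j ≡ a + 1 → a ≡ j
  a≡j {a} e = suc-injective (trans (+-comm 1 a) (sym e))

  binom-pow2-four : ∀ j k → 0 < k → k < 2 ^ suc j → k ≢ 2 ^ j → 4 ∣ binom (2 ^ suc j) k
  binom-pow2-four j k 0<k k<2^j+1 k≢2^j with pow2-odd-decomposition k 0<k
  ... | a , o , o-odd , refl with suc j ∸ suc a | exponent-gap a o (suc j) o-odd k<2^j+1
  ...   | suc d | E≡ = ∣-trans (divides (2 ^ d) (4*-comm d))
                               (subst (λ e → 2 ^ suc (suc d) ∣ binom (2 ^ e) (2 ^ a * o)) (sym E≡) (binom-pow2-divisible a (suc (suc d)) o o-odd))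
    where
    4*-comm : ∀ d → 2 ^ suc (suc d) ≡ 2 ^ d * 4
    4*-comm d = trans (sym (*-assoc 2 2 (2 ^ d))) (*-comm 4 (2 ^ d))
  ...   | zero  | E≡ with o | o-odd
  ...     | 1            | _ = contradiction (trans (cong (λ e → 2 ^ e * 1) (a≡j E≡)) (*-identityʳ (2 ^ j))) k≢2^j
  ...     | suc (suc o′) | _ = contradiction (subst (_≤ 2 ^ a * suc (suc o′)) 2^a*2≡ (*-monoʳ-≤ (2 ^ a) (s≤s (s≤s z≤n)))) (<⇒≱ k<2^j+1)
    where
    2^a*2≡ : 2 ^ a * 2 ≡ 2 ^ suc j
    2^a*2≡ = trans (*-comm (2 ^ a) 2) (cong (λ e → 2 ^ suc e) (a≡j E≡))

  odd+⇒odd : ∀ x y → (x + y) % 2 ≡ 0 → x % 2 ≡ 1 → y % 2 ≡ 1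
  odd+⇒odd x y x+y-even x-odd with %2-cases y
  ... | inj₂ y-odd  = y-odd
  ... | inj₁ y-even = contradiction (trans (sym (%-distribˡ-+ x y 2)) x+y-even) 1≢0
    where
    1≢0 : ((x % 2) + (y % 2)) % 2 ≢ 0
    1≢0 rewrite x-odd | y-even = λ ()

  -- Pascal's rule turns the evenness of the inner entries of row 2^E into the oddness of all of row 2^E − 1.
  binom-pred-pow2-odd : ∀ E N → 2 ^ E ≡ suc N → ∀ i → i ≤ N → binom N i % 2 ≡ 1
  binom-pred-pow2-odd E N 2^E≡ zero    _   = refl
  binom-pred-pow2-odd E N 2^E≡ (suc i) i<N =
    odd+⇒odd (binom N i) (binom N (suc i)) (n∣m⇒m%n≡0 _ 2 pascal-even) (binom-pred-pow2-odd E N 2^E≡ i (≤-trans (n≤1+n i) i<N))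
    where
    pascal-even : 2 ∣ binom (suc N) (suc i)
    pascal-even = subst (λ z → 2 ∣ binom z (suc i)) 2^E≡ (binom-pow2-even E (suc i) (s≤s z≤n) (subst (suc i <_) (sym 2^E≡) (s≤s i<N)))

  double-odd-%4 : ∀ y → y % 2 ≡ 1 → (2 * y) % 4 ≡ 2
  double-odd-%4 y y-odd = begin
    (2 * y) % 4                        ≡⟨ cong (λ z → (2 * z) % 4) (m≡m%n+[m/n]*n y 2) ⟩
    (2 * (y % 2 + (y / 2) * 2)) % 4    ≡⟨ cong (λ z → (2 * (z + (y / 2) * 2)) % 4) y-odd ⟩
    (2 * (1 + (y / 2) * 2)) % 4        ≡⟨ cong (_% 4) (distrib (y / 2)) ⟩
    (2 + (y / 2) * 4) % 4              ≡⟨ [m+kn]%n≡m%n 2 (y / 2) 4 ⟩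
    2                                  ∎
    where
    distrib : ∀ q → 2 * (1 + q * 2) ≡ 2 + q * 4
    distrib = solve-∀

  binom-central-pow2 : ∀ j → binom (2 ^ suc j) (2 ^ j) % 4 ≡ 2
  binom-central-pow2 j with 2 ^ j in 2^j≡ | m^n>0 2 j
  ... | suc m | _ = begin
    binom (2 * suc m) (suc m) % 4      ≡⟨ cong (_% 4) (binom-central m) ⟩
    (2 * binom (m + suc m) m) % 4      ≡⟨ double-odd-%4 (binom (m + suc m) m) (binom-pred-pow2-odd (suc j) (m + suc m) 2^j+1≡ m (m≤m+n m _)) ⟩
    2                                  ∎
    where
    2^j+1≡ : 2 ^ suc j ≡ suc (m + suc m)
    2^j+1≡ = trans (cong (2 *_) 2^j≡) (cong (suc m +_) (+-identityʳ (suc m)))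

  -- βcount modulo 4

  parity : List Bool → Bool
  parity []      = false
  parity (b ∷ w) = b xor parity w

  -- the parity of all entries except the one at (0-based) position p
  parityExcept : ℕ → List Bool → Bool
  parityExcept p       []      = false
  parityExcept zero    (b ∷ w) = parity w
  parityExcept (suc p) (b ∷ w) = b xor parityExcept p w

  prefixed : ℕ → Bool → List Bool → List Bool
  prefixed a b R = replicate a false ++ b ∷ R

  parity-ascending : ∀ a → parity (replicate a false) ≡ false
  parity-ascending zero    = refl
  parity-ascending (suc a) = parity-ascending a

  parityExcept-ascending : ∀ p a → parityExcept p (replicate a false) ≡ false
  parityExcept-ascending p       zero    = refl
  parityExcept-ascending zero    (suc a) = parity-ascending a
  parityExcept-ascending (suc p) (suc a) = parityExcept-ascending p a

  parity-flip : ∀ a R → parity (prefixed a true R) ≡ not (parity (prefixed a false R))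
  parity-flip zero    R = refl
  parity-flip (suc a) R = parity-flip a R

  parityExcept-flip : ∀ p a R → a ≢ p → parityExcept p (prefixed a true R) ≡ not (parityExcept p (prefixed a false R))
  parityExcept-flip zero    zero    R a≢p = contradiction refl a≢p
  parityExcept-flip (suc p) zero    R a≢p = refl
  parityExcept-flip zero    (suc a) R a≢p = parity-flip a R
  parityExcept-flip (suc p) (suc a) R a≢p = parityExcept-flip p a R (a≢p ∘ cong suc)

  parityExcept-skip : ∀ p R → parityExcept p (prefixed p true R) ≡ parityExcept p (prefixed p false R)
  parityExcept-skip zero    R = refl
  parityExcept-skip (suc p) R = parityExcept-skip p R

  prefixed-false : ∀ a R → prefixed a false R ≡ replicate (suc a) false ++ R
  prefixed-false zero    R = refl
  prefixed-false (suc a) R = cong (false ∷_) (prefixed-false a R)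

  scan-induction : (P : List Bool → Set) →
    (∀ a → P (replicate a false)) → (∀ a R → P (prefixed a false R) → P (prefixed a true R)) → ∀ S → P S
  scan-induction P base set-bit S = from 0 S
    where
    from : ∀ a R → P (replicate a false ++ R)
    from a []          = subst P (sym (++-identityʳ (replicate a false))) (base a)
    from a (false ∷ R) = subst P (sym (prefixed-false a R)) (from (suc a) R)
    from a (true ∷ R)  = set-bit a R (subst P (sym (prefixed-false a R)) (from (suc a) R))

  length-prefixed : ∀ a b R → length (prefixed a b R) ≡ a + suc (length R)
  length-prefixed a b R = trans (length-++ (replicate a false)) (cong (_+ suc (length R)) (length-replicate a))

  βcount-split-prefixed : ∀ a R → βcount (prefixed a false R) + βcount (prefixed a true R) ≡ binom (suc (a + suc (length R))) (suc a) * βcount R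
  βcount-split-prefixed a R = begin
    βcount (prefixed a false R) + βcount (prefixed a true R)
      ≡⟨ βcount-split (replicate a false) R ⟩
    binom (suc (length (replicate a false) + suc (length R))) (suc (length (replicate a false))) * βcount (replicate a false) * βcount R
      ≡⟨ cong₂ (λ ℓ c → binom (suc (ℓ + suc (length R))) (suc ℓ) * c * βcount R) (length-replicate a) (βcount-ascending a) ⟩
    binom (suc (a + suc (length R))) (suc a) * 1 * βcount R
      ≡⟨ cong (_* βcount R) (*-identityʳ (binom (suc (a + suc (length R))) (suc a))) ⟩
    binom (suc (a + suc (length R))) (suc a) * βcount R
      ∎

  pred-pow2-suc : ∀ j → suc (pred (2 ^ j)) ≡ 2 ^ j
  pred-pow2-suc j = suc-pred (2 ^ j) {{m^n≢0 2 j}}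

  prefixed-length-pow2 : ∀ a b R j → length (prefixed a b R) ≡ pred (2 ^ j) → suc (a + suc (length R)) ≡ 2 ^ j
  prefixed-length-pow2 a b R j len = trans (cong suc (trans (sym (length-prefixed a b R)) len)) (pred-pow2-suc j)

  a+1<a+1+r : ∀ a r → suc a < suc (a + suc r)
  a+1<a+1+r a r = s≤s (subst (suc a ≤_) (sym (+-suc a r)) (s≤s (m≤m+n a r)))

  βcount-odd : ∀ j R → length R ≡ pred (2 ^ j) → βcount R % 2 ≡ 1
  βcount-odd j = scan-induction (λ S → length S ≡ pred (2 ^ j) → βcount S % 2 ≡ 1) (λ a _ → cong (_% 2) (βcount-ascending a)) set-bit
    where
    set-bit : ∀ a R → (length (prefixed a false R) ≡ pred (2 ^ j) → βcount (prefixed a false R) % 2 ≡ 1) →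
              length (prefixed a true R) ≡ pred (2 ^ j) → βcount (prefixed a true R) % 2 ≡ 1
    set-bit a R ih len = odd+⇒odd (βcount (prefixed a false R)) (βcount (prefixed a true R))
                           (n∣m⇒m%n≡0 _ 2 sum-even) (ih (trans (length-prefixed a false R) (trans (sym (length-prefixed a true R)) len)))
      where
      N≡ = prefixed-length-pow2 a true R j len
      sum-even : 2 ∣ βcount (prefixed a false R) + βcount (prefixed a true R)
      sum-even = subst (2 ∣_) (sym (βcount-split-prefixed a R))
        (∣m⇒∣m*n (βcount R) (subst (λ N → 2 ∣ binom N (suc a)) (sym N≡)
          (binom-pow2-even j (suc a) (s≤s z≤n) (subst (suc a <_) N≡ (a+1<a+1+r a (length R))))))

  oddResidue : Bool → ℕ
  oddResidue false = 1
  oddResidue true  = 3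

  residue-negate : ∀ b s → s < 4 → (oddResidue b + s) % 4 ≡ 0 → s ≡ oddResidue (not b)
  residue-negate false 3 _ _ = refl
  residue-negate true  1 _ _ = refl
  residue-negate false 0 _ ()
  residue-negate false 1 _ ()
  residue-negate false 2 _ ()
  residue-negate true  0 _ ()
  residue-negate true  2 _ ()
  residue-negate true  3 _ ()
  residue-negate _ (suc (suc (suc (suc _)))) (s≤s (s≤s (s≤s (s≤s ()))))

  residue-keep : ∀ b s → s < 4 → (oddResidue b + s) % 4 ≡ 2 → s ≡ oddResidue b
  residue-keep false 1 _ _ = refl
  residue-keep true  3 _ _ = refl
  residue-keep false 0 _ ()
  residue-keep false 2 _ ()
  residue-keep false 3 _ ()
  residue-keep true  0 _ ()
  residue-keep true  1 _ ()
  residue-keep true  2 _ ()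
  residue-keep _ (suc (suc (suc (suc _)))) (s≤s (s≤s (s≤s (s≤s ()))))

  %4-residue-sum : ∀ x y b → x % 4 ≡ oddResidue b → (x + y) % 4 ≡ (oddResidue b + y % 4) % 4
  %4-residue-sum x y b x≡ = trans (%-distribˡ-+ x y 4) (cong (λ r → (r + y % 4) % 4) x≡)

  *-%4-two : ∀ c z → c % 4 ≡ 2 → z % 2 ≡ 1 → (c * z) % 4 ≡ 2
  *-%4-two c z c≡2 z-odd = begin
    (c * z) % 4                 ≡⟨ %-distribˡ-* c z 4 ⟩
    ((c % 4) * (z % 4)) % 4     ≡⟨ cong (λ r → (r * (z % 4)) % 4) c≡2 ⟩
    (2 * (z % 4)) % 4           ≡⟨ %-distribˡ-* 2 z 4 ⟨
    (2 * z) % 4                 ≡⟨ double-odd-%4 z z-odd ⟩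
    2                           ∎

  βcount-split-middle-mod4 : ∀ j a R → suc (a + suc (length R)) ≡ 2 ^ suc j → suc a ≡ 2 ^ j →
    (βcount (prefixed a false R) + βcount (prefixed a true R)) % 4 ≡ 2
  βcount-split-middle-mod4 j a R N≡ a+1≡2^j = begin
    (βcount (prefixed a false R) + βcount (prefixed a true R)) % 4
      ≡⟨ cong (_% 4) (βcount-split-prefixed a R) ⟩
    (binom (suc (a + suc r)) (suc a) * βcount R) % 4
      ≡⟨ cong₂ (λ N k → (binom N k * βcount R) % 4) N≡ a+1≡2^j ⟩
    (binom (2 ^ suc j) (2 ^ j) * βcount R) % 4
      ≡⟨ *-%4-two (binom (2 ^ suc j) (2 ^ j)) (βcount R) (binom-central-pow2 j) (βcount-odd j R r≡) ⟩
    2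
      ∎
    where
    r = length R
    r≡ : r ≡ pred (2 ^ j)
    r≡ = cong pred (+-cancelˡ-≡ (2 ^ j) (suc r) (2 ^ j) (begin
      2 ^ j + suc r      ≡⟨ cong (_+ suc r) a+1≡2^j ⟨
      suc a + suc r      ≡⟨ N≡ ⟩
      2 * 2 ^ j          ≡⟨ cong (2 ^ j +_) (+-identityʳ (2 ^ j)) ⟩
      2 ^ j + 2 ^ j      ∎))

  βcount-split-off-middle-mod4 : ∀ j a R → suc (a + suc (length R)) ≡ 2 ^ suc j → suc a ≢ 2 ^ j →
    (βcount (prefixed a false R) + βcount (prefixed a true R)) % 4 ≡ 0
  βcount-split-off-middle-mod4 j a R N≡ a+1≢2^j = begin
    (βcount (prefixed a false R) + βcount (prefixed a true R)) % 4
      ≡⟨ cong (_% 4) (trans (βcount-split-prefixed a R) (cong (λ N → binom N (suc a) * βcount R) N≡)) ⟩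
    (binom (2 ^ suc j) (suc a) * βcount R) % 4
      ≡⟨ n∣m⇒m%n≡0 _ 4 (∣m⇒∣m*n (βcount R) (binom-pow2-four j (suc a) (s≤s z≤n) a+1<N a+1≢2^j)) ⟩
    0
      ∎
    where
    a+1<N : suc a < 2 ^ suc j
    a+1<N = subst (suc a <_) N≡ (a+1<a+1+r a (length R))

  βcount-mod4 : ∀ j S → length S ≡ pred (2 ^ suc j) → βcount S % 4 ≡ oddResidue (parityExcept (pred (2 ^ j)) S)
  βcount-mod4 j = scan-induction (λ S → length S ≡ pred (2 ^ suc j) → βcount S % 4 ≡ oddResidue (parityExcept p S))
    (λ a _ → trans (cong (_% 4) (βcount-ascending a)) (cong oddResidue (sym (parityExcept-ascending p a))))
    set-bit
    where
    p = pred (2 ^ j)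
    set-bit : ∀ a R → (length (prefixed a false R) ≡ pred (2 ^ suc j) → βcount (prefixed a false R) % 4 ≡ oddResidue (parityExcept p (prefixed a false R))) →
              length (prefixed a true R) ≡ pred (2 ^ suc j) → βcount (prefixed a true R) % 4 ≡ oddResidue (parityExcept p (prefixed a true R))
    set-bit a R ih len = conclude (suc a ≟ 2 ^ j)
      where
      S₀ = prefixed a false R
      S₁ = prefixed a true R
      e₀ = parityExcept p S₀
      N≡ = prefixed-length-pow2 a true R (suc j) len
      sum-residue : (βcount S₀ + βcount S₁) % 4 ≡ (oddResidue e₀ + βcount S₁ % 4) % 4
      sum-residue = %4-residue-sum (βcount S₀) (βcount S₁) e₀ (ih (trans (length-prefixed a false R) (trans (sym (length-prefixed a true R)) len)))
      conclude : Dec (suc a ≡ 2 ^ j) → βcount S₁ % 4 ≡ oddResidue (parityExcept p S₁)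
      conclude (yes a+1≡2^j) = subst (λ e → βcount S₁ % 4 ≡ oddResidue e)
        (sym (subst (λ q → parityExcept q S₁ ≡ parityExcept q S₀) (cong pred a+1≡2^j) (parityExcept-skip a R)))
        (residue-keep e₀ (βcount S₁ % 4) (m%n<n (βcount S₁) 4) (trans (sym sum-residue) (βcount-split-middle-mod4 j a R N≡ a+1≡2^j)))
      conclude (no a+1≢2^j) = subst (λ e → βcount S₁ % 4 ≡ oddResidue e)
        (sym (parityExcept-flip p a R (λ a≡p → a+1≢2^j (trans (cong suc a≡p) (pred-pow2-suc j)))))
        (residue-negate e₀ (βcount S₁ % 4) (m%n<n (βcount S₁) 4) (trans (sym sum-residue) (βcount-split-off-middle-mod4 j a R N≡ a+1≢2^j)))

module Reduction where

  open import Data.Nat as ℕ using (ℕ; zero; suc; _∸_; _^_; _%_; pred)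
  import Data.Nat.Properties as ℕ
  open import Data.Nat.DivMod using (m≡m%n+[m/n]*n)
  open import Data.Integer using (ℤ; +_; -[1+_]; _+_; _*_; -_; _-_)
  import Data.Integer.Properties as ℤ
  open import Data.Integer.Tactic.RingSolver using (solve-∀)
  open import Data.Bool using (Bool; true; false; not; _xor_)
  open import Data.Bool.Properties using (xor-assoc; not-distribˡ-xor; not-distribʳ-xor; not-involutive; xor-comm; true-xor)
  open import Data.List using (List; []; _∷_; _++_; length; map)
  open import Data.List.Properties using (length-++)
  open import Data.Product using (∃; _×_; _,_; proj₁; proj₂)
  open import Relation.Binary.PropositionalEquality
  open ≡-Reasoning
  open ListSum ℤ.+-*-semiring
  open Counting using (binom; βcount; βcount-split; βcount-complement; β≡βcount; parity; parityExcept; oddResidue; βcount-mod4; pred-pow2-suc)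

  -- Remainders modulo (t² + 1)²

  shiftℤ : (ℕ → ℤ) → ℕ → ℤ
  shiftℤ f zero    = + 0
  shiftℤ f (suc k) = f k

  coeff-+ₚ : ∀ p q k → coeff (p +ₚ q) k ≡ coeff p k + coeff q k
  coeff-+ₚ []      q       k       = sym (ℤ.+-identityˡ (coeff q k))
  coeff-+ₚ (a ∷ p) []      k       = sym (ℤ.+-identityʳ (coeff (a ∷ p) k))
  coeff-+ₚ (a ∷ p) (b ∷ q) zero    = refl
  coeff-+ₚ (a ∷ p) (b ∷ q) (suc k) = coeff-+ₚ p q k

  coeff-scale : ∀ c p k → coeff (scale c p) k ≡ c * coeff p k
  coeff-scale c []      k       = sym (ℤ.*-zeroʳ c)
  coeff-scale c (a ∷ p) zero    = refl
  coeff-scale c (a ∷ p) (suc k) = coeff-scale c p k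

  coeff-*ₚ-∷ˡ : ∀ a d r k → coeff ((a ∷ d) *ₚ r) k ≡ a * coeff r k + shiftℤ (coeff (d *ₚ r)) k
  coeff-*ₚ-∷ˡ a d r zero    = trans (coeff-+ₚ (scale a r) (+ 0 ∷ (d *ₚ r)) zero) (cong (_+ + 0) (coeff-scale a r zero))
  coeff-*ₚ-∷ˡ a d r (suc k) = trans (coeff-+ₚ (scale a r) (+ 0 ∷ (d *ₚ r)) (suc k)) (cong (_+ coeff (d *ₚ r) k) (coeff-scale a r (suc k)))

  coeff-*ₚ-[] : ∀ d k → coeff (d *ₚ []) k ≡ + 0
  coeff-*ₚ-[] []      k       = refl
  coeff-*ₚ-[] (a ∷ d) zero    = trans (coeff-*ₚ-∷ˡ a d [] zero) (cong (_+ + 0) (ℤ.*-zeroʳ a))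
  coeff-*ₚ-[] (a ∷ d) (suc k) = trans (coeff-*ₚ-∷ˡ a d [] (suc k)) (cong₂ _+_ (ℤ.*-zeroʳ a) (coeff-*ₚ-[] d k))

  coeff-*ₚ-+ₚ : ∀ d p q k → coeff (d *ₚ (p +ₚ q)) k ≡ coeff (d *ₚ p) k + coeff (d *ₚ q) k
  coeff-*ₚ-+ₚ []      p q k = refl
  coeff-*ₚ-+ₚ (a ∷ d) p q k = begin
    coeff ((a ∷ d) *ₚ (p +ₚ q)) k
      ≡⟨ coeff-*ₚ-∷ˡ a d (p +ₚ q) k ⟩
    a * coeff (p +ₚ q) k + shiftℤ (coeff (d *ₚ (p +ₚ q))) k
      ≡⟨ cong₂ _+_ (cong (a *_) (coeff-+ₚ p q k)) (shifted k) ⟩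
    a * (coeff p k + coeff q k) + (shiftℤ (coeff (d *ₚ p)) k + shiftℤ (coeff (d *ₚ q)) k)
      ≡⟨ distrib a (coeff p k) (coeff q k) _ _ ⟩
    (a * coeff p k + shiftℤ (coeff (d *ₚ p)) k) + (a * coeff q k + shiftℤ (coeff (d *ₚ q)) k)
      ≡⟨ cong₂ _+_ (coeff-*ₚ-∷ˡ a d p k) (coeff-*ₚ-∷ˡ a d q k) ⟨
    coeff ((a ∷ d) *ₚ p) k + coeff ((a ∷ d) *ₚ q) k
      ∎
    where
    shifted : ∀ k → shiftℤ (coeff (d *ₚ (p +ₚ q))) k ≡ shiftℤ (coeff (d *ₚ p)) k + shiftℤ (coeff (d *ₚ q)) k
    shifted zero    = refl
    shifted (suc k) = coeff-*ₚ-+ₚ d p q k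
    distrib : ∀ a x y u v → a * (x + y) + (u + v) ≡ (a * x + u) + (a * y + v)
    distrib = solve-∀

  coeff-*ₚ-∷ʳ : ∀ d c q k → coeff (d *ₚ (c ∷ q)) k ≡ c * coeff d k + shiftℤ (coeff (d *ₚ q)) k
  coeff-*ₚ-∷ʳ []      c q zero    = sym (trans (ℤ.+-identityʳ (c * + 0)) (ℤ.*-zeroʳ c))
  coeff-*ₚ-∷ʳ []      c q (suc k) = sym (trans (ℤ.+-identityʳ (c * + 0)) (ℤ.*-zeroʳ c))
  coeff-*ₚ-∷ʳ (a ∷ d) c q zero    = trans (coeff-*ₚ-∷ˡ a d (c ∷ q) zero) (trans (ℤ.+-identityʳ (a * c)) (trans (ℤ.*-comm a c) (sym (ℤ.+-identityʳ (c * a)))))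
  coeff-*ₚ-∷ʳ (a ∷ d) c q (suc k) = begin
    coeff ((a ∷ d) *ₚ (c ∷ q)) (suc k)
      ≡⟨ coeff-*ₚ-∷ˡ a d (c ∷ q) (suc k) ⟩
    a * coeff q k + coeff (d *ₚ (c ∷ q)) k
      ≡⟨ cong (_+_ (a * coeff q k)) (coeff-*ₚ-∷ʳ d c q k) ⟩
    a * coeff q k + (c * coeff d k + shiftℤ (coeff (d *ₚ q)) k)
      ≡⟨ swap (a * coeff q k) (c * coeff d k) _ ⟩
    c * coeff d k + (a * coeff q k + shiftℤ (coeff (d *ₚ q)) k)
      ≡⟨ cong (_+_ (c * coeff d k)) (coeff-*ₚ-∷ˡ a d q k) ⟨
    c * coeff (a ∷ d) (suc k) + shiftℤ (coeff ((a ∷ d) *ₚ q)) (suc k)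
      ∎
    where
    swap : ∀ x y z → x + (y + z) ≡ y + (x + z)
    swap = solve-∀

  record Cubic : Set where
    constructor cubic
    field
      r₀ r₁ r₂ r₃ : ℤ
  open Cubic

  cubicCoeff : Cubic → ℕ → ℤ
  cubicCoeff r 0 = r₀ r
  cubicCoeff r 1 = r₁ r
  cubicCoeff r 2 = r₂ r
  cubicCoeff r 3 = r₃ r
  cubicCoeff r (suc (suc (suc (suc k)))) = + 0

  -- t · (r₀ + r₁ t + r₂ t² + r₃ t³) = r₃ (t² + 1)² + (− r₃ + r₀ t + (r₁ − 2 r₃) t² + r₂ t³)
  remainder : ℕ → Cubic
  remainder zero    = cubic (+ 1) (+ 0) (+ 0) (+ 0)
  remainder (suc b) = cubic (- r₃ r) (r₀ r) (r₁ r - + 2 * r₃ r) (r₂ r)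
    where r = remainder b

  quotient : ℕ → Poly
  quotient zero    = []
  quotient (suc b) = r₃ (remainder b) ∷ quotient b

  monomial-division : ∀ b k → coeff ((Φ₄ *ₚ Φ₄) *ₚ quotient b) k ≡ coeff (monomial b) k - cubicCoeff (remainder b) k
  monomial-division zero k = trans (coeff-*ₚ-[] (Φ₄ *ₚ Φ₄) k) (vanish k)
    where
    vanish : ∀ k → + 0 ≡ coeff (monomial 0) k - cubicCoeff (remainder 0) k
    vanish 0 = refl
    vanish 1 = refl
    vanish 2 = refl
    vanish 3 = refl
    vanish (suc (suc (suc (suc k)))) = refl
  monomial-division (suc b) k = trans (coeff-*ₚ-∷ʳ (Φ₄ *ₚ Φ₄) x (quotient b) k) (step k)
    where
    x = r₃ (remainder b)
    r = remainder b
    step : ∀ k → x * coeff (Φ₄ *ₚ Φ₄) k + shiftℤ (coeff ((Φ₄ *ₚ Φ₄) *ₚ quotient b)) k ≡ coeff (monomial (suc b)) k - cubicCoeff (remainder (suc b)) k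
    step 0 = c₀ x
      where
      c₀ : ∀ x → x * + 1 + + 0 ≡ + 0 - (- x)
      c₀ = solve-∀
    step 1 = trans (cong (_+_ (x * + 0)) (monomial-division b 0)) (c₁ x (coeff (monomial b) 0) (r₀ r))
      where
      c₁ : ∀ x m y → x * + 0 + (m - y) ≡ m - y
      c₁ = solve-∀
    step 2 = trans (cong (_+_ (x * + 2)) (monomial-division b 1)) (c₂ x (coeff (monomial b) 1) (r₁ r))
      where
      c₂ : ∀ x m y → x * + 2 + (m - y) ≡ m - (y - + 2 * x)
      c₂ = solve-∀
    step 3 = trans (cong (_+_ (x * + 0)) (monomial-division b 2)) (c₃ x (coeff (monomial b) 2) (r₂ r))
      where
      c₃ : ∀ x m y → x * + 0 + (m - y) ≡ m - y
      c₃ = solve-∀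
    step 4 = trans (cong (_+_ (x * + 1)) (monomial-division b 3)) (c₄ x (coeff (monomial b) 3))
      where
      c₄ : ∀ x m → x * + 1 + (m - x) ≡ m - + 0
      c₄ = solve-∀
    step (suc (suc (suc (suc (suc k))))) =
      trans (cong (_+_ (x * + 0)) (monomial-division b (suc (suc (suc (suc k)))))) (c₅ x (coeff (monomial b) (suc (suc (suc (suc k))))))
      where
      c₅ : ∀ x m → x * + 0 + (m - + 0) ≡ m - + 0
      c₅ = solve-∀

  -- iPow b = (Re iᵇ , Im iᵇ)
  iPow : ℕ → ℤ × ℤ
  iPow zero    = (+ 1 , + 0)
  iPow (suc b) = (- proj₂ (iPow b) , proj₁ (iPow b))

  -- The remainder r of tᵇ modulo (t² + 1)² is fixed by r(±i) = (±i)ᵇ and r′(±i) = b (±i)ᵇ⁻¹.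
  RemainderFormula : ℕ → Set
  RemainderFormula b =
    (+ 2 * r₀ (remainder b) ≡ c * (+ 2 - + b)) × (+ 2 * r₁ (remainder b) ≡ s * (+ 3 - + b)) ×
    (+ 2 * r₂ (remainder b) ≡ - (c * + b))     × (+ 2 * r₃ (remainder b) ≡ s * (+ 1 - + b))
    where
    c = proj₁ (iPow b)
    s = proj₂ (iPow b)

  remainder-formula : ∀ b → RemainderFormula b
  remainder-formula zero = refl , refl , refl , refl
  remainder-formula (suc b) with remainder-formula b
  ... | e₀ , e₁ , e₂ , e₃ =
    trans (f₀ (r₃ r)) (trans (cong -_ e₃) (f₁ s (+ b))) ,
    trans e₀ (f₂ c (+ b)) ,
    trans (f₃ (r₁ r) (r₃ r)) (trans (cong₂ (λ u v → u - + 2 * v) e₁ e₃) (f₄ s (+ b))) ,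
    trans e₂ (f₅ c (+ b))
    where
    r = remainder b
    c = proj₁ (iPow b)
    s = proj₂ (iPow b)
    f₀ : ∀ x → + 2 * (- x) ≡ - (+ 2 * x)
    f₀ = solve-∀
    f₁ : ∀ s b → - (s * (+ 1 - b)) ≡ (- s) * (+ 2 - (+ 1 + b))
    f₁ = solve-∀
    f₂ : ∀ c b → c * (+ 2 - b) ≡ c * (+ 3 - (+ 1 + b))
    f₂ = solve-∀
    f₃ : ∀ x y → + 2 * (x - + 2 * y) ≡ + 2 * x - + 2 * (+ 2 * y)
    f₃ = solve-∀
    f₄ : ∀ s b → s * (+ 3 - b) - + 2 * (s * (+ 1 - b)) ≡ - ((- s) * (+ 1 + b))
    f₄ = solve-∀
    f₅ : ∀ c b → - (c * b) ≡ c * (+ 1 - (+ 1 + b))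
    f₅ = solve-∀

  iPow-+4 : ∀ b → iPow (4 ℕ.+ b) ≡ iPow b
  iPow-+4 b = cong₂ _,_ (ℤ.neg-involutive _) (ℤ.neg-involutive _)

  iPow-mod4 : ∀ b → iPow b ≡ iPow (b % 4)
  iPow-mod4 b = trans (cong iPow (trans (m≡m%n+[m/n]*n b 4) (ℕ.+-comm (b % 4) _))) (periodic (b ℕ./ 4) (b % 4))
    where
    periodic : ∀ q r → iPow (q ℕ.* 4 ℕ.+ r) ≡ iPow r
    periodic zero    r = refl
    periodic (suc q) r = trans (iPow-+4 (q ℕ.* 4 ℕ.+ r)) (periodic q r)

  sgn : Bool → ℤ
  sgn false = + 1
  sgn true  = - + 1

  iPow-oddResidue : ∀ b e → b % 4 ≡ oddResidue e → iPow b ≡ (+ 0 , sgn e)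
  iPow-oddResidue b e b≡ = trans (iPow-mod4 b) (trans (cong iPow b≡) (odd e))
    where
    odd : ∀ e → iPow (oddResidue e) ≡ (+ 0 , sgn e)
    odd false = refl
    odd true  = refl

  ∑-neg : {A : Set} (f : A → ℤ) (xs : List A) → ∑ (λ x → - f x) xs ≡ - ∑ f xs
  ∑-neg f xs = trans (∑-cong (λ x → sym (ℤ.-1*i≡-i (f x))) xs) (trans (∑-*ˡ (- + 1) f xs) (ℤ.-1*i≡-i _))

  x≡-x⇒x≡0 : ∀ x → x ≡ - x → x ≡ + 0
  x≡-x⇒x≡0 (+ zero)          _  = refl
  x≡-x⇒x≡0 (+ suc _)         ()
  x≡-x⇒x≡0 -[1+ _ ]          ()

  2*x≡0⇒x≡0 : ∀ x → + 2 * x ≡ + 0 → x ≡ + 0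
  2*x≡0⇒x≡0 x 2x≡0 = ℤ.*-cancelˡ-≡ (+ 2) x (+ 0) (trans 2x≡0 (sym (ℤ.*-zeroʳ (+ 2))))

  sgn-xor : ∀ x y → sgn (x xor y) ≡ sgn x * sgn y
  sgn-xor true  true  = refl
  sgn-xor true  false = refl
  sgn-xor false y     = sym (ℤ.*-identityˡ (sgn y))

  sgn-not : ∀ x → sgn (not x) ≡ - sgn x
  sgn-not true  = refl
  sgn-not false = refl

  isOdd : ℕ → Bool
  isOdd zero    = false
  isOdd (suc n) = not (isOdd n)

  isOdd-double+1 : ∀ a → isOdd (suc (a ℕ.+ a)) ≡ true
  isOdd-double+1 zero    = refl
  isOdd-double+1 (suc a) = trans (cong (λ z → not (not (isOdd z))) (ℕ.+-suc a a)) (trans (cong not (not-involutive _)) (isOdd-double+1 a))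

  parity-complement : ∀ L → parity (map not L) ≡ parity L xor isOdd (length L)
  parity-complement []      = refl
  parity-complement (b ∷ L) = begin
    not b xor parity (map not L)                  ≡⟨ cong (not b xor_) (parity-complement L) ⟩
    not b xor (parity L xor isOdd (length L))     ≡⟨ not-distribˡ-xor b _ ⟨
    not (b xor (parity L xor isOdd (length L)))   ≡⟨ cong not (xor-assoc b (parity L) _) ⟨
    not ((b xor parity L) xor isOdd (length L))   ≡⟨ not-distribʳ-xor (b xor parity L) _ ⟩
    (b xor parity L) xor not (isOdd (length L))   ∎

  parityExcept-middle : ∀ L b R → parityExcept (length L) (L ++ b ∷ R) ≡ parity L xor parity R
  parityExcept-middle []      b R = refl
  parityExcept-middle (c ∷ L) b R = trans (cong (c xor_) (parityExcept-middle L b R)) (sym (xor-assoc c (parity L) (parity R)))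

  -- Toggling the first bit, which parityExcept (suc q) counts, pairs the words off with opposite signs.
  ∑-sgn-parityExcept : ∀ q N → ∑ (λ S → sgn (parityExcept (suc q) S)) (words bits (suc N)) ≡ + 0
  ∑-sgn-parityExcept q N = begin
    ∑ (λ S → sgn (parityExcept (suc q) S)) (words bits (suc N))
      ≡⟨ ∑-words-suc bits N (λ S → sgn (parityExcept (suc q) S)) ⟩
    ∑ (λ w → sgn (not (parityExcept q w))) (words bits N) + (σ + + 0)
      ≡⟨ cong (_+ (σ + + 0)) (trans (∑-cong (λ w → sgn-not (parityExcept q w)) (words bits N)) (∑-neg (λ w → sgn (parityExcept q w)) (words bits N))) ⟩
    - σ + (σ + + 0)
      ≡⟨ cancel σ ⟩
    + 0
      ∎
    where
    σ = ∑ (λ w → sgn (parityExcept q w)) (words bits N)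
    cancel : ∀ x → - x + (x + + 0) ≡ + 0
    cancel = solve-∀

  -- Complementing an odd-length word keeps βcount and flips the parity.
  ∑-sgn-parity-βcount : ∀ ℓ → isOdd ℓ ≡ true → ∑ (λ R → sgn (parity R) * + βcount R) (words bits ℓ) ≡ + 0
  ∑-sgn-parity-βcount ℓ ℓ-odd = x≡-x⇒x≡0 _ (begin
    ∑ g (words bits ℓ)                   ≡⟨ ∑-words-complement ℓ g ⟩
    ∑ (λ R → g (map not R)) (words bits ℓ) ≡⟨ ∑-words-cong bits ℓ g-complement ⟩
    ∑ (λ R → - g R) (words bits ℓ)       ≡⟨ ∑-neg g (words bits ℓ) ⟩
    - ∑ g (words bits ℓ)                 ∎)
    where
    g : List Bool → ℤ
    g R = sgn (parity R) * + βcount R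
    g-complement : ∀ R → length R ≡ ℓ → g (map not R) ≡ - g R
    g-complement R |R|≡ℓ = begin
      sgn (parity (map not R)) * + βcount (map not R)
        ≡⟨ cong₂ (λ e c → sgn e * + c) (parity-complement R) (βcount-complement R) ⟩
      sgn (parity R xor isOdd (length R)) * + βcount R
        ≡⟨ cong (λ o → sgn (parity R xor o) * + βcount R) (trans (cong isOdd |R|≡ℓ) ℓ-odd) ⟩
      sgn (parity R xor true) * + βcount R
        ≡⟨ cong (λ e → sgn e * + βcount R) (trans (xor-comm (parity R) true) (true-xor (parity R))) ⟩
      sgn (not (parity R)) * + βcount R
        ≡⟨ cong (_* + βcount R) (sgn-not (parity R)) ⟩
      - sgn (parity R) * + βcount R
        ≡⟨ ℤ.neg-distribˡ-* (sgn (parity R)) (+ βcount R) ⟨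
      - g R
        ∎

  coeff-sumₚ : ∀ ps k → coeff (sumₚ ps) k ≡ ∑ (λ P → coeff P k) ps
  coeff-sumₚ []       k = refl
  coeff-sumₚ (P ∷ ps) k = trans (coeff-+ₚ P (sumₚ ps) k) (cong (_+_ (coeff P k)) (coeff-sumₚ ps k))

  coeff-*ₚ-sumₚ : ∀ d ps k → coeff (d *ₚ sumₚ ps) k ≡ ∑ (λ P → coeff (d *ₚ P) k) ps
  coeff-*ₚ-sumₚ d []       k = coeff-*ₚ-[] d k
  coeff-*ₚ-sumₚ d (P ∷ ps) k = trans (coeff-*ₚ-+ₚ d P (sumₚ ps) k) (cong (_+_ (coeff (d *ₚ P) k)) (coeff-*ₚ-sumₚ d ps k))

  -- When iᵇ = s·i, twice the remainder of tᵇ is s·((3 − b) t + (1 − b) t³): its k-th coefficient is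
  -- s·(u − v b) for (u , v) = oddRemainder k.
  oddRemainder : ℕ → ℤ × ℤ
  oddRemainder 1 = (+ 3 , + 1)
  oddRemainder 3 = (+ 1 , + 1)
  oddRemainder _ = (+ 0 , + 0)

  remainder-odd : ∀ b s → iPow b ≡ (+ 0 , s) → ∀ k →
    + 2 * cubicCoeff (remainder b) k ≡ s * (proj₁ (oddRemainder k) - proj₂ (oddRemainder k) * + b)
  remainder-odd b s iPow≡ k with remainder-formula b
  ... | e₀ , e₁ , e₂ , e₃ rewrite iPow≡ = by-coefficient k
    where
    by-coefficient : ∀ k → + 2 * cubicCoeff (remainder b) k ≡ s * (proj₁ (oddRemainder k) - proj₂ (oddRemainder k) * + b)
    by-coefficient 0 = trans e₀ (z₀ s (+ b))
      where
      z₀ : ∀ s b → + 0 * (+ 2 - b) ≡ s * (+ 0 - + 0 * b)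
      z₀ = solve-∀
    by-coefficient 1 = trans e₁ (o₁ s (+ b))
      where
      o₁ : ∀ s b → s * (+ 3 - b) ≡ s * (+ 3 - + 1 * b)
      o₁ = solve-∀
    by-coefficient 2 = trans e₂ (z₂ s (+ b))
      where
      z₂ : ∀ s b → - (+ 0 * b) ≡ s * (+ 0 - + 0 * b)
      z₂ = solve-∀
    by-coefficient 3 = trans e₃ (o₃ s (+ b))
      where
      o₃ : ∀ s b → s * (+ 1 - b) ≡ s * (+ 1 - + 1 * b)
      o₃ = solve-∀
    by-coefficient (suc (suc (suc (suc k)))) = z s (+ b)
      where
      z : ∀ s b → + 2 * + 0 ≡ s * (+ 0 - + 0 * b)
      z = solve-∀

  -- The signed sums for n = 2^(i+2)

  module PowerOfTwo (i : ℕ) where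

    m = 2 ^ suc i
    n = 2 ℕ.* m
    p = pred m

    m≡ : m ≡ suc p
    m≡ = sym (pred-pow2-suc (suc i))

    n∸1≡ : n ∸ 1 ≡ p ℕ.+ suc p
    n∸1≡ = trans (cong (λ z → 2 ℕ.* z ∸ 1) m≡) (cong (p ℕ.+_) (ℕ.+-identityʳ (suc p)))

    β≡ : ∀ S → length S ≡ n ∸ 1 → β n S ≡ βcount S
    β≡ S |S|≡ = trans (cong (λ z → β z S) n≡) (β≡βcount S)
      where
      n≡ : n ≡ suc (length S)
      n≡ = trans (sym (ℕ.m+[n∸m]≡n (ℕ.m^n>0 2 (suc (suc i))))) (cong suc (sym |S|≡))

    ε : List Bool → ℤ
    ε S = sgn (parityExcept p S)

    ε-middle : ∀ (L : List Bool) b R → length L ≡ p → ε (L ++ b ∷ R) ≡ sgn (parity L) * sgn (parity R)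
    ε-middle L b R |L|≡p = trans (cong (λ q → sgn (parityExcept q (L ++ b ∷ R))) (sym |L|≡p))
                                 (trans (cong sgn (parityExcept-middle L b R)) (sgn-xor (parity L) (parity R)))

    p≡odd : ∃ λ a → p ≡ suc (a ℕ.+ a)
    p≡odd with 2 ^ i | ℕ.m^n>0 2 i
    ... | suc a | _ = a , trans (ℕ.+-suc a (a ℕ.+ 0)) (cong (λ z → suc (a ℕ.+ z)) (ℕ.+-identityʳ a))

    iPow-β : ∀ S → length S ≡ n ∸ 1 → iPow (β n S) ≡ (+ 0 , ε S)
    iPow-β S |S|≡ = iPow-oddResidue (β n S) (parityExcept p S)
      (trans (cong (_% 4) (β≡ S |S|≡)) (βcount-mod4 (suc i) S (trans |S|≡ (∸1≡pred n))))
      where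
      ∸1≡pred : ∀ x → x ∸ 1 ≡ pred x
      ∸1≡pred zero    = refl
      ∸1≡pred (suc x) = refl

    ∑-ε : ∑ ε (subsets n) ≡ + 0
    ∑-ε with a , p≡ ← p≡odd = begin
      ∑ (λ S → sgn (parityExcept p S)) (words bits (n ∸ 1))
        ≡⟨ cong (λ z → ∑ (λ S → sgn (parityExcept p S)) (words bits z)) (trans n∸1≡ (ℕ.+-suc p p)) ⟩
      ∑ (λ S → sgn (parityExcept p S)) (words bits (suc (p ℕ.+ p)))
        ≡⟨ cong (λ q → ∑ (λ S → sgn (parityExcept q S)) (words bits (suc (p ℕ.+ p)))) p≡ ⟩
      ∑ (λ S → sgn (parityExcept (suc (a ℕ.+ a)) S)) (words bits (suc (p ℕ.+ p)))
        ≡⟨ ∑-sgn-parityExcept (a ℕ.+ a) (p ℕ.+ p) ⟩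
      + 0
        ∎

    length-middle : ∀ (L : List Bool) b R → length L ≡ p → length R ≡ p → length (L ++ b ∷ R) ≡ n ∸ 1
    length-middle L b R |L|≡p |R|≡p = trans (length-++ L) (trans (cong₂ (λ u v → u ℕ.+ suc v) |L|≡p |R|≡p) (sym n∸1≡))

    ∑-middle : ∀ (L R : List Bool) → length L ≡ p → length R ≡ p →
      ε (L ++ true ∷ R) * + β n (L ++ true ∷ R) + ε (L ++ false ∷ R) * + β n (L ++ false ∷ R)
        ≡ sgn (parity L) * + (binom (suc (p ℕ.+ suc p)) (suc p) ℕ.* βcount L) * (sgn (parity R) * + βcount R)
    ∑-middle L R |L|≡p |R|≡p = begin
      ε S₁ * + β n S₁ + ε S₀ * + β n S₀
        ≡⟨ cong₂ _+_ (cong₂ (λ e b → e * + b) (ε-middle L true R |L|≡p) (β≡ S₁ (length-middle L true R |L|≡p |R|≡p)))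
                     (cong₂ (λ e b → e * + b) (ε-middle L false R |L|≡p) (β≡ S₀ (length-middle L false R |L|≡p |R|≡p))) ⟩
      sL * sR * + βcount S₁ + sL * sR * + βcount S₀
        ≡⟨ ℤ.*-distribˡ-+ (sL * sR) (+ βcount S₁) (+ βcount S₀) ⟨
      sL * sR * (+ βcount S₁ + + βcount S₀)
        ≡⟨ cong (λ z → sL * sR * z) (trans (sym (ℤ.pos-+ (βcount S₁) (βcount S₀))) (cong +_ (trans (ℕ.+-comm (βcount S₁) (βcount S₀)) split))) ⟩
      sL * sR * + (K ℕ.* βcount L ℕ.* βcount R)
        ≡⟨ cong (λ z → sL * sR * z) (ℤ.pos-* (K ℕ.* βcount L) (βcount R)) ⟩
      sL * sR * (+ (K ℕ.* βcount L) * + βcount R)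
        ≡⟨ regroup sL sR (+ (K ℕ.* βcount L)) (+ βcount R) ⟩
      sL * + (K ℕ.* βcount L) * (sR * + βcount R)
        ∎
      where
      S₀ = L ++ false ∷ R
      S₁ = L ++ true ∷ R
      sL = sgn (parity L)
      sR = sgn (parity R)
      K  = binom (suc (p ℕ.+ suc p)) (suc p)
      split : βcount S₀ ℕ.+ βcount S₁ ≡ K ℕ.* βcount L ℕ.* βcount R
      split = trans (βcount-split L R) (cong (λ z → z ℕ.* βcount L ℕ.* βcount R) (cong₂ (λ u v → binom (suc (u ℕ.+ suc v)) (suc u)) |L|≡p |R|≡p))
      regroup : ∀ x y u v → x * y * (u * v) ≡ x * u * (y * v)
      regroup = solve-∀

    ∑-εβ : ∑ (λ S → ε S * + β n S) (subsets n) ≡ + 0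
    ∑-εβ = begin
      ∑ f (words bits (n ∸ 1))
        ≡⟨ cong (λ z → ∑ f (words bits z)) n∸1≡ ⟩
      ∑ f (words bits (p ℕ.+ suc p))
        ≡⟨ ∑-words-++ bits p (suc p) f ⟩
      ∑ (λ L → ∑ (λ w → f (L ++ w)) (words bits (suc p))) (words bits p)
        ≡⟨ ∑-words-cong bits p (λ L |L|≡p → ∑-right-half L |L|≡p) ⟩
      ∑ (λ _ → + 0) (words bits p)
        ≡⟨ ∑-zero (words bits p) ⟩
      + 0
        ∎
      where
      f : List Bool → ℤ
      f S = ε S * + β n S
      ∑-right-half : ∀ L → length L ≡ p → ∑ (λ w → f (L ++ w)) (words bits (suc p)) ≡ + 0
      ∑-right-half L |L|≡p = begin
        ∑ (λ w → f (L ++ w)) (words bits (suc p))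
          ≡⟨ ∑-words-suc bits p (λ w → f (L ++ w)) ⟩
        ∑ (λ R → f (L ++ true ∷ R)) (words bits p) + (∑ (λ R → f (L ++ false ∷ R)) (words bits p) + + 0)
          ≡⟨ cong (_+_ (∑ (λ R → f (L ++ true ∷ R)) (words bits p))) (ℤ.+-identityʳ _) ⟩
        ∑ (λ R → f (L ++ true ∷ R)) (words bits p) + ∑ (λ R → f (L ++ false ∷ R)) (words bits p)
          ≡⟨ ∑-+ (λ R → f (L ++ true ∷ R)) (λ R → f (L ++ false ∷ R)) (words bits p) ⟨
        ∑ (λ R → f (L ++ true ∷ R) + f (L ++ false ∷ R)) (words bits p)
          ≡⟨ ∑-words-cong bits p (λ R |R|≡p → ∑-middle L R |L|≡p |R|≡p) ⟩
        ∑ (λ R → c * (sgn (parity R) * + βcount R)) (words bits p)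
          ≡⟨ ∑-*ˡ c (λ R → sgn (parity R) * + βcount R) (words bits p) ⟩
        c * ∑ (λ R → sgn (parity R) * + βcount R) (words bits p)
          ≡⟨ cong (c *_) (∑-sgn-parity-βcount p p-odd) ⟩
        c * + 0
          ≡⟨ ℤ.*-zeroʳ c ⟩
        + 0
          ∎
        where
        c = sgn (parity L) * + (binom (suc (p ℕ.+ suc p)) (suc p) ℕ.* βcount L)
        p-odd : isOdd p ≡ true
        p-odd with a , p≡ ← p≡odd = trans (cong isOdd p≡) (isOdd-double+1 a)

    ∑-remainder : ∀ k → ∑ (λ S → cubicCoeff (remainder (β n S)) k) (subsets n) ≡ + 0
    ∑-remainder k = 2*x≡0⇒x≡0 _ (begin
      + 2 * ∑ (λ S → cubicCoeff (remainder (β n S)) k) (subsets n)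
        ≡⟨ ∑-*ˡ (+ 2) (λ S → cubicCoeff (remainder (β n S)) k) (subsets n) ⟨
      ∑ (λ S → + 2 * cubicCoeff (remainder (β n S)) k) (subsets n)
        ≡⟨ ∑-words-cong bits (n ∸ 1) (λ S |S|≡ → trans (remainder-odd (β n S) (ε S) (iPow-β S |S|≡) k) (expand (ε S) u v (+ β n S))) ⟩
      ∑ (λ S → u * ε S + - (v * (ε S * + β n S))) (subsets n)
        ≡⟨ ∑-+ (λ S → u * ε S) (λ S → - (v * (ε S * + β n S))) (subsets n) ⟩
      ∑ (λ S → u * ε S) (subsets n) + ∑ (λ S → - (v * (ε S * + β n S))) (subsets n)
        ≡⟨ cong₂ _+_ (∑-*ˡ u ε (subsets n)) (trans (∑-neg _ (subsets n)) (cong -_ (∑-*ˡ v (λ S → ε S * + β n S) (subsets n)))) ⟩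
      u * ∑ ε (subsets n) + - (v * ∑ (λ S → ε S * + β n S) (subsets n))
        ≡⟨ cong₂ (λ x y → u * x + - (v * y)) ∑-ε ∑-εβ ⟩
      u * + 0 + - (v * + 0)
        ≡⟨ vanish u v ⟩
      + 0
        ∎)
      where
      u = proj₁ (oddRemainder k)
      v = proj₂ (oddRemainder k)
      expand : ∀ e u v b → e * (u - v * b) ≡ u * e + - (v * (e * b))
      expand = solve-∀
      vanish : ∀ u v → u * + 0 + - (v * + 0) ≡ + 0
      vanish = solve-∀

    Q-divisible : (Φ₄ *ₚ Φ₄) ∣ₚ Q n
    Q-divisible = sumₚ (map (λ S → quotient (β n S)) (subsets n)) , λ k → begin
      coeff ((Φ₄ *ₚ Φ₄) *ₚ sumₚ (map (λ S → quotient (β n S)) (subsets n))) k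
        ≡⟨ coeff-*ₚ-sumₚ (Φ₄ *ₚ Φ₄) (map (λ S → quotient (β n S)) (subsets n)) k ⟩
      ∑ (λ P → coeff ((Φ₄ *ₚ Φ₄) *ₚ P) k) (map (λ S → quotient (β n S)) (subsets n))
        ≡⟨ ∑-map (λ P → coeff ((Φ₄ *ₚ Φ₄) *ₚ P) k) (λ S → quotient (β n S)) (subsets n) ⟩
      ∑ (λ S → coeff ((Φ₄ *ₚ Φ₄) *ₚ quotient (β n S)) k) (subsets n)
        ≡⟨ ∑-cong (λ S → monomial-division (β n S) k) (subsets n) ⟩
      ∑ (λ S → coeff (monomial (β n S)) k - cubicCoeff (remainder (β n S)) k) (subsets n)
        ≡⟨ ∑-+ (λ S → coeff (monomial (β n S)) k) (λ S → - cubicCoeff (remainder (β n S)) k) (subsets n) ⟩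
      ∑ (λ S → coeff (monomial (β n S)) k) (subsets n) + ∑ (λ S → - cubicCoeff (remainder (β n S)) k) (subsets n)
        ≡⟨ cong (_+_ (∑ (λ S → coeff (monomial (β n S)) k) (subsets n))) (trans (∑-neg _ (subsets n)) (cong -_ (∑-remainder k))) ⟩
      ∑ (λ S → coeff (monomial (β n S)) k) (subsets n) + - + 0
        ≡⟨ ℤ.+-identityʳ _ ⟩
      ∑ (λ S → coeff (monomial (β n S)) k) (subsets n)
        ≡⟨ ∑-map (λ P → coeff P k) (λ S → monomial (β n S)) (subsets n) ⟨
      ∑ (λ P → coeff P k) (map (λ S → monomial (β n S)) (subsets n))
        ≡⟨ coeff-sumₚ (map (λ S → monomial (β n S)) (subsets n)) k ⟨
      coeff (Q n) k
        ∎

theorem7p4 : (j : ℕ) → 4 ≤ 2 ^ j → (Φ₄ *ₚ Φ₄) ∣ₚ Q (2 ^ j)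
theorem7p4 zero          (s≤s ())
theorem7p4 (suc zero)    (s≤s (s≤s ()))
theorem7p4 (suc (suc i)) _ = Reduction.PowerOfTwo.Q-divisible i
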